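{- In the setting described in the context, the map $\theta:S\times S\to\mathbb{Z}_3$ satisfies: (i) $\theta(L,L)=0$ for every $L\in S$; (ii) $\theta(L_2,L_1)=-\theta(L_1,L_2)$ for all $L_1,L_2\in S$; (iii) if $L_1,L_2,L_3\in S$ are contained in a grid of $Q$, then $\theta(L_1,L_2)+\theta(L_2,L_3)=\theta(L_1,L_3)$; (iv) if $L_1,L_2,L_3\in S$ are not contained in a grid of $Q$, then $\theta(L_1,L_2)+\theta(L_2,L_3)\neq\theta(L_1,L_3)$.
   Context: Let $\Delta$ be the near hexagon $Q(5,2)\otimes Q(5,2)$, i.e. the (up to isomorphism unique) slim dense near hexagon on $243$ points (slim: every line has $3$ points; dense: any two points at distance $2$ have at least two common neighbours). $Q(5,2)$ is the generalized quadrangle of order $(2,4)$ and $W(2)$ the generalized quadrangle of order $(2,2)$. The following known facts fix notation. Any two points of $\Delta$ lie in a unique quad (convex subspace of diameter $2$), whose points and lines form a $(3\times3)$-grid or a $Q(5,2)$. If $Q$ is a $Q(5,2)$-quad and $x\notin Q$, then $x$ is collinear with a unique point $\pi_Q(x)$ of $Q$; for $x\in Q$ put $\pi_Q(x):=x$; $\mathcal{R}_Q(x)$ denotes the third point of the line $x\pi_Q(x)$ (and $\mathcal{R}_Q(x)=x$ if $x\in Q$). There are two partitions $T_1,T_2$ of the point set of $\Delta$ into $Q(5,2)$-quads such that every element of $T_1$ meets every element of $T_2$ in a line. Fix distinct $Q,\overline{Q}\in T_1$ and put $\overline{\overline{Q}}:=\mathcal{R}_Q(\overline{Q})$. Let $S:=\{Q\cap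 Q_2: Q_2\in T_2\}$, a spread of the generalized quadrangle $Q$. For $L\in S$ let $R_L$ be the element of $T_2$ containing $L$. Fix $L^*\in S$ and put $R^*:=R_{L^*}$. The set $R^*\cap(Q\cup\overline{Q}\cup\overline{\overline{Q}})$ is a $(3\times3)$-subgrid of $R^*$ contained in exactly three $W(2)$-subquadrangles $W^0,W^1,W^2$ of $R^*$ (indexed by $\mathbb{Z}_3$ in a fixed way). For every ordered pair $(L_1,L_2)$ of lines of $S$, the map $x\mapsto\pi_{R^*}\circ\pi_{R_{L_2}}\circ\pi_{R_{L_1}}(x)$ is an automorphism of $R^*$, and there is a unique $\theta(L_1,L_2)\in\mathbb{Z}_3$ with $\pi_{R^*}\circ\pi_{R_{L_2}}\circ\pi_{R_{L_1}}(W^i)=W^{i+\theta(L_1,L_2)}$ for every $i\in\mathbb{Z}_3$. A grid of $Q$ means a $(3\times3)$-subgrid of $Q$. -}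

module Defs where

open import Data.Nat using (ℕ; zero; suc; _∸_) renaming (_+_ to _+ℕ_; _*_ to _*ℕ_)
open import Data.Nat.DivMod using (_%_; m%n<n)
open import Data.Fin using (Fin; toℕ; fromℕ<) renaming (zero to f0; suc to fs)
open import Data.Bool using (Bool; true; false)
open import Data.Product using (Σ; ∃; _×_; _,_; proj₁; proj₂)
open import Data.Sum using (_⊎_)
open import Relation.Binary.PropositionalEquality using (_≡_; _≢_)
open import Relation.Nullary using (¬_)

Z3 : Set
Z3 = Fin 3

mod3 : ℕ → Z3
mod3 n = fromℕ< (m%n<n n 3)

infixl 6 _+₃_ _-₃_
infixl 7 _*₃_

_+₃_ : Z3 → Z3 → Z3
a +₃ b = mod3 (toℕ a +ℕ toℕ b)

_*₃_ : Z3 → Z3 → Z3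
a *₃ b = mod3 (toℕ a *ℕ toℕ b)

-₃_ : Z3 → Z3
-₃ a = mod3 (3 ∸ toℕ a)

_-₃_ : Z3 → Z3 → Z3
a -₃ b = a +₃ (-₃ b)

0₃ : Z3
0₃ = f0

V : Set
V = Z3 × Z3

_+ᵥ_ : V → V → V
(a , b) +ᵥ (c , d) = (a +₃ c , b +₃ d)

_·ᵥ_ : Z3 → V → V
t ·ᵥ (a , b) = (t *₃ a , t *₃ b)

det : V → V → Z3
det (a , b) (c , d) = a *₃ d -₃ b *₃ c

-- the four directions (points of PG(1,3)) of AG(2,3)
data Dir : Set where
  d01 d10 d11 d12 : Dir

dirV : Dir → V
dirV d01 = (f0 , fs f0)
dirV d10 = (fs f0 , f0)
dirV d11 = (fs f0 , fs f0)
dirV d12 = (fs f0 , fs (fs f0))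

-- A model of the generalized quadrangle Q(5,2) of order (2,4):
-- points (x , k) ∈ AG(2,3) × Z3 (27 points); lines (45):
--   * spreadLine x        = { (x , k) : k ∈ Z3 }                      (9 lines)
--   * transLine p d a     = { (p + t d , a + t·det(p,d)) : t ∈ Z3 }  (36 lines)
-- (two distinct points (x,k),(y,l) are collinear iff x = y, or
--  l - k = det(x,y)).  The spreadLines form a (regular) spread.

GQPt : Set
GQPt = V × Z3

data GQLine : Set where
  spreadLine : V → GQLine
  transLine  : V → Dir → Z3 → GQLine

GQOn : GQPt → GQLine → Set
GQOn (x , k) (spreadLine y) = x ≡ y
GQOn (x , k) (transLine p d a) =
  Σ Z3 λ t → (x ≡ p +ᵥ (t ·ᵥ dirV d)) × (k ≡ a +₃ t *₃ det p (dirV d))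

-- The near hexagon Δ = Q(5,2) ⊗ Q(5,2).  Lines (729):
--   * qLine i M = { (i , j , k) : (j , k) on M }   (lines of the quad Q_i)
--   * rLine j M = { (i , j , k) : (i , k) on M }   (lines of the quad R_j)

Point : Set
Point = V × V × Z3

data Line : Set where
  qLine : V → GQLine → Line
  rLine : V → GQLine → Line

On : Point → Line → Set
On (i , j , k) (qLine i' M) = (i ≡ i') × GQOn (j , k) M
On (i , j , k) (rLine j' M) = (j ≡ j') × GQOn (i , k) M

PSet : Set₁
PSet = Point → Set

infix 4 _≐_ _⊆_
_≐_ : PSet → PSet → Set
A ≐ B = ∀ x → (A x → B x) × (B x → A x)

_⊆_ : PSet → PSet → Set
A ⊆ B = ∀ x → A x → B x

_∩_ : PSet → PSet → PSet
(A ∩ B) x = A x × B x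

_∪_ : PSet → PSet → PSet
(A ∪ B) x = A x ⊎ B x

pts : Line → PSet
pts L x = On x L

Collinear : Point → Point → Set
Collinear x y = (x ≢ y) × ∃ λ L → On x L × On y L

-- In this model the Q(5,2)-quads are exactly the 18 sets
--   Qc i = { (i , _ , _) }   and   Rc j = { (_ , j , _) }.
-- The Boolean chooses which of the two partitions is called T₁.

Qc : V → PSet
Qc i (i' , j , k) = i' ≡ i

Rc : V → PSet
Rc j (i , j' , k) = j' ≡ j

T₁ : Bool → V → PSet
T₁ true  = Qc
T₁ false = Rc

T₂ : Bool → V → PSet
T₂ true  = Rc
T₂ false = Qc

Proj : PSet → Point → Point → Set
Proj A x y = (A x × y ≡ x) ⊎ ((¬ A x) × A y × Collinear x y)

ThirdPoint : Point → Point → Point → Set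
ThirdPoint x y z =
  (z ≢ x) × (z ≢ y) × ∃ λ L → On x L × On y L × On z L

Refl : PSet → Point → Point → Set
Refl A x z = (A x × z ≡ x) ⊎ ((¬ A x) × ∃ λ y → Proj A x y × ThirdPoint x y z)

ImageR : (Point → Point → Set) → PSet → PSet
ImageR f X z = ∃ λ x → X x × f x z

-- Subquadrangles.  X ⊆ A (with the lines of Δ contained in X) is a
-- generalized quadrangle of order (2 , t); all lines of Δ have 3 points.

LineIn : PSet → Line → Set
LineIn X L = pts L ⊆ X

SameLine : Line → Line → Set
SameLine L M = pts L ≐ pts M

CollIn : PSet → Point → Point → Set
CollIn X x y = (x ≢ y) × ∃ λ L → LineIn X L × On x L × On y L

record SubGQ (A X : PSet) (t : ℕ) : Set where
  field
    sub      : X ⊆ A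
    nonempty : ∃ X
    linesAt  : ∀ x → X x →
      Σ (Fin (suc t) → Line) λ f →
        (∀ n → LineIn X (f n) × On x (f n)) ×
        (∀ n m → SameLine (f n) (f m) → n ≡ m) ×
        (∀ L → LineIn X L → On x L → ∃ λ n → SameLine L (f n))
    gqAxiom  : ∀ x L → X x → LineIn X L → ¬ On x L →
      ∃ λ y → On y L × CollIn X x y ×
        (∀ z → On z L → CollIn X x z → z ≡ y)

IsW2Sub : PSet → PSet → Set
IsW2Sub A X = SubGQ A X 2

IsGrid : PSet → PSet → Set
IsGrid A X = SubGQ A X 1

module Setting (b : Bool) (iQ iQ̄ : V) (jL* : V) where

  Q Q̄ Q̿ : PSet
  Q  = T₁ b iQ
  Q̄  = T₁ b iQ̄
  Q̿  = ImageR (Refl Q) Q̄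

  -- the spread S of Q: L ranges over V via L_j = Q ∩ R_j, R_{L_j} = R_j
  R : V → PSet
  R = T₂ b

  S-line : V → PSet
  S-line j = Q ∩ R j

  R* : PSet
  R* = R jL*

  G* : PSet
  G* = R* ∩ (Q ∪ (Q̄ ∪ Q̿))

  Φ : V → V → Point → Point → Set
  Φ j₁ j₂ x z = ∃ λ y₁ → ∃ λ y₂ →
    Proj (R j₁) x y₁ × Proj (R j₂) y₁ y₂ × Proj R* y₂ z

  IsIndexing : (Z3 → PSet) → Set₁
  IsIndexing W =
    (∀ n → IsW2Sub R* (W n) × G* ⊆ W n) ×
    (∀ n m → W n ≐ W m → n ≡ m) ×
    (∀ X → IsW2Sub R* X → G* ⊆ X → ∃ λ n → X ≐ W n)

  IsTheta : (Z3 → PSet) → V → V → Z3 → Set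
  IsTheta W j₁ j₂ t = ∀ n → ImageR (Φ j₁ j₂) (W n) ≐ W (n +₃ t)

  InGrid : V → V → V → Set₁
  InGrid j₁ j₂ j₃ = ∃ λ (X : PSet) → IsGrid Q X ×
    S-line j₁ ⊆ X × S-line j₂ ⊆ X × S-line j₃ ⊆ X

-- In the model, π_{R_j} (i , j′ , k) = (i , j , k + det j′ j), so on R* the map
-- π_{R*} ∘ π_{R_{j₂}} ∘ π_{R_{j₁}} is the shift k ↦ k + c j₁ j₂ along the fibres,
-- with c j₁ j₂ = det j* j₁ + det j₁ j₂ + det j₂ j*. Shifts preserve G* and
-- W(2)-subquadrangles, so the shift by 1 permutes W⁰, W¹, W²; its cube is the
-- identity, hence it is a translation by some s, and θ = c · s. Now c vanishes on
-- the diagonal, is antisymmetric, and c j₁ j₂ + c j₂ j₃ = c j₁ j₃ + area j₁ j₂ j₃,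
-- where area vanishes iff j₁, j₂, j₃ are collinear in AG(2,3), iff the spread lines
-- L_{j₁}, L_{j₂}, L_{j₃} lie in a grid of Q. It remains that s ≠ 0: otherwise W⁰
-- would be a union of fibres meeting the fibres over the line of AG(2,3) through
-- the indices of Q and Q̄, and counting lines through one point of W⁰ rules that
-- out. Exchanging T₁ and T₂ is the automorphism (i , j , k) ↦ (j , i , k).

module Submission where

open import Defs
open import Data.Bool using (Bool; true; false)
open import Data.Empty using (⊥; ⊥-elim)
open import Data.Fin using (Fin; _≟_) renaming (zero to f0; suc to fs)
open import Data.Fin.Properties using (all?; any?; pigeonhole; <⇒≢)
open import Data.Nat using (ℕ; suc; _<_; s≤s; z≤n)
open import Data.Nat.Properties using (n<1+n)
open import Data.Product using (Σ; ∃; ∃₂; _×_; _,_; proj₁; proj₂)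
open import Data.Product.Properties using (≡-dec)
open import Data.Sum using (_⊎_; inj₁; inj₂)
open import Function using (_∘_)
open import Data.Vec using ([]; _∷_; lookup)
open import Relation.Binary.Definitions using (DecidableEquality)
open import Relation.Binary.PropositionalEquality
open import Relation.Nullary using (Dec; yes; no; ¬_)
open import Relation.Nullary.Decidable using (from-yes; map′; _×-dec_; _→-dec_; ¬?)

1₃ 2₃ : Z3
1₃ = fs f0
2₃ = fs (fs f0)

-ᵥ_ : V → V
-ᵥ (a , b) = (-₃ a , -₃ b)

infixl 6 _-ᵥ_
_-ᵥ_ : V → V → V
u -ᵥ v = u +ᵥ (-ᵥ v)

third : V → V → V
third u v = -ᵥ (u +ᵥ v)

i-of j-of : Point → V
i-of (i , _ , _) = i
j-of (_ , j , _) = j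

k-of : Point → Z3
k-of (_ , _ , k) = k

-- The lines of Δ are the cosets of subgroups of order 3 of V × V × Z3, so the
-- third point of a line through x and y is -(x + y).
thirdₚ : Point → Point → Point
thirdₚ (i , j , k) (i′ , j′ , l) = (third i i′ , third j j′ , -₃ (k +₃ l))

infix 4 _≟ᵥ_ _≟ₚ_
_≟ᵥ_ : DecidableEquality V
_≟ᵥ_ = ≡-dec _≟_ _≟_

_≟ₚ_ : DecidableEquality Point
_≟ₚ_ = ≡-dec _≟ᵥ_ (≡-dec _≟ᵥ_ _≟_)

allV? : {P : V → Set} → (∀ v → Dec (P v)) → Dec (∀ v → P v)
allV? P? = map′ (λ h v → h (proj₁ v) (proj₂ v)) (λ h a b → h (a , b)) (all? λ a → all? λ b → P? (a , b))

allDir? : {P : Dir → Set} → (∀ d → Dec (P d)) → Dec (∀ d → P d)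
allDir? P? with P? d01 | P? d10 | P? d11 | P? d12
... | yes p | yes q | yes r | yes s = yes λ { d01 → p ; d10 → q ; d11 → r ; d12 → s }
... | no ¬p | _     | _     | _     = no λ h → ¬p (h d01)
... | yes _ | no ¬q | _     | _     = no λ h → ¬q (h d10)
... | yes _ | yes _ | no ¬r | _     = no λ h → ¬r (h d11)
... | yes _ | yes _ | yes _ | no ¬s = no λ h → ¬s (h d12)

abstract
  +₃-identityʳ : ∀ a → a +₃ 0₃ ≡ a
  +₃-identityʳ = from-yes (all? λ a → a +₃ 0₃ ≟ a)

  k+c-c≡k : ∀ k c → (k +₃ c) +₃ (-₃ c) ≡ k
  k+c-c≡k = from-yes (all? λ k → all? λ c → (k +₃ c) +₃ (-₃ c) ≟ k)

  k-c+c≡k : ∀ k c → (k +₃ (-₃ c)) +₃ c ≡ k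
  k-c+c≡k = from-yes (all? λ k → all? λ c → (k +₃ (-₃ c)) +₃ c ≟ k)

  +₃-swapʳ : ∀ a b c → (a +₃ b) +₃ c ≡ (a +₃ c) +₃ b
  +₃-swapʳ = from-yes (all? λ a → all? λ b → all? λ c → (a +₃ b) +₃ c ≟ (a +₃ c) +₃ b)

  +₃-assoc₄ : ∀ k a b c → ((k +₃ a) +₃ b) +₃ c ≡ k +₃ ((a +₃ b) +₃ c)
  +₃-assoc₄ = from-yes (all? λ k → all? λ a → all? λ b → all? λ c →
    ((k +₃ a) +₃ b) +₃ c ≟ k +₃ ((a +₃ b) +₃ c))

  +₃-sub : ∀ a b → a +₃ (b -₃ a) ≡ b
  +₃-sub = from-yes (all? λ a → all? λ b → a +₃ (b -₃ a) ≟ b)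

  +₃-1₃-≢ : ∀ a → a ≢ a +₃ 1₃
  +₃-1₃-≢ = from-yes (all? λ a → ¬? (a ≟ a +₃ 1₃))

  third-self : ∀ u → third u u ≡ u
  third-self = from-yes (allV? λ u → third u u ≟ᵥ u)

  third-comm : ∀ u v → third u v ≡ third v u
  third-comm = from-yes (allV? λ u → allV? λ v → third u v ≟ᵥ third v u)

  det-self : ∀ u → det u u ≡ 0₃
  det-self = from-yes (allV? λ u → det u u ≟ 0₃)

  distinct-third : ∀ a b c → a ≢ b → a ≢ c → b ≢ c → c ≡ -₃ (a +₃ b)
  distinct-third = from-yes (all? λ a → all? λ b → all? λ c →
    ¬? (a ≟ b) →-dec (¬? (a ≟ c) →-dec (¬? (b ≟ c) →-dec (c ≟ -₃ (a +₃ b)))))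

gqPoint : GQLine → Z3 → GQPt
gqPoint (spreadLine y) t = (y , t)
gqPoint (transLine p d a) t = (p +ᵥ (t ·ᵥ dirV d) , a +₃ t *₃ det p (dirV d))

point : Line → Z3 → Point
point (qLine i M) t = (i , gqPoint M t)
point (rLine j M) t = (proj₁ (gqPoint M t) , j , proj₂ (gqPoint M t))

gqPoint-on : ∀ M t → GQOn (gqPoint M t) M
gqPoint-on (spreadLine y) t = refl
gqPoint-on (transLine p d a) t = (t , refl , refl)

point-on : ∀ L t → On (point L t) L
point-on (qLine i M) t = (refl , gqPoint-on M t)
point-on (rLine j M) t = (refl , gqPoint-on M t)

gqPoint-surjective : ∀ {g} M → GQOn g M → ∃ λ t → g ≡ gqPoint M t
gqPoint-surjective {u , k} (spreadLine y) refl = (k , refl)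
gqPoint-surjective (transLine p d a) (t , refl , refl) = (t , refl)

point-surjective : ∀ {x} L → On x L → ∃ λ t → x ≡ point L t
point-surjective (qLine i M) (refl , g) with gqPoint-surjective M g
... | t , refl = (t , refl)
point-surjective (rLine j M) (refl , g) with gqPoint-surjective M g
... | t , refl = (t , refl)

abstract
  translate-injective : ∀ p d t s → p +ᵥ (t ·ᵥ dirV d) ≡ p +ᵥ (s ·ᵥ dirV d) → t ≡ s
  translate-injective = from-yes (allV? λ p → allDir? λ d → all? λ t → all? λ s →
    (p +ᵥ (t ·ᵥ dirV d) ≟ᵥ p +ᵥ (s ·ᵥ dirV d)) →-dec (t ≟ s))

  transLine-third : ∀ p d a t s →
    gqPoint (transLine p d a) (-₃ (t +₃ s)) ≡
      (third (proj₁ (gqPoint (transLine p d a) t)) (proj₁ (gqPoint (transLine p d a) s)) ,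
       -₃ (proj₂ (gqPoint (transLine p d a) t) +₃ proj₂ (gqPoint (transLine p d a) s)))
  transLine-third = from-yes (allV? λ p → allDir? λ d → all? λ a → all? λ t → all? λ s →
    ≡-dec _≟ᵥ_ _≟_ (gqPoint (transLine p d a) (-₃ (t +₃ s)))
      (third (proj₁ (gqPoint (transLine p d a) t)) (proj₁ (gqPoint (transLine p d a) s)) ,
       -₃ (proj₂ (gqPoint (transLine p d a) t) +₃ proj₂ (gqPoint (transLine p d a) s))))

gqPoint-injective : ∀ M t s → gqPoint M t ≡ gqPoint M s → t ≡ s
gqPoint-injective (spreadLine y) t s e = cong proj₂ e
gqPoint-injective (transLine p d a) t s e = translate-injective p d t s (cong proj₁ e)

point-injective : ∀ L t s → point L t ≡ point L s → t ≡ s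
point-injective (qLine i M) t s e = gqPoint-injective M t s (cong proj₂ e)
point-injective (rLine j M) t s e = gqPoint-injective M t s (cong (λ x → (i-of x , k-of x)) e)

gqPoint-third : ∀ M t s → gqPoint M (-₃ (t +₃ s)) ≡
  (third (proj₁ (gqPoint M t)) (proj₁ (gqPoint M s)) , -₃ (proj₂ (gqPoint M t) +₃ proj₂ (gqPoint M s)))
gqPoint-third (spreadLine y) t s = cong (_, -₃ (t +₃ s)) (sym (third-self y))
gqPoint-third (transLine p d a) t s = transLine-third p d a t s

point-third : ∀ L t s → point L (-₃ (t +₃ s)) ≡ thirdₚ (point L t) (point L s)
point-third (qLine i M) t s = cong₂ _,_ (sym (third-self i)) (gqPoint-third M t s)
point-third (rLine j M) t s =
  cong₂ (λ g u → (proj₁ g , u , proj₂ g)) (gqPoint-third M t s) (sym (third-self j))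

third-on : ∀ {x y} L → On x L → On y L → On (thirdₚ x y) L
third-on L x∈L y∈L with point-surjective L x∈L | point-surjective L y∈L
... | t , refl | s , refl = subst (λ z → On z L) (point-third L t s) (point-on L (-₃ (t +₃ s)))

third-of-distinct : ∀ {x y z} L → On x L → On y L → On z L →
  x ≢ y → x ≢ z → y ≢ z → z ≡ thirdₚ x y
third-of-distinct L x∈L y∈L z∈L x≢y x≢z y≢z
  with point-surjective L x∈L | point-surjective L y∈L | point-surjective L z∈L
... | t , refl | s , refl | r , refl =
  trans (cong (point L) (distinct-third t s r (x≢y ∘ cong (point L)) (x≢z ∘ cong (point L))
                                             (y≢z ∘ cong (point L))))
        (point-third L t s)

same-line-of-two-points⊆ : ∀ {x y} L M → On x L → On y L → On x M → On y M → x ≢ y →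
  pts L ⊆ pts M
same-line-of-two-points⊆ {x} {y} L M x∈L y∈L x∈M y∈M x≢y z z∈L with z ≟ₚ x | z ≟ₚ y
... | yes refl | _ = x∈M
... | no _ | yes refl = y∈M
... | no z≢x | no z≢y =
  subst (λ w → On w M)
    (sym (third-of-distinct L x∈L y∈L z∈L x≢y (z≢x ∘ sym) (z≢y ∘ sym)))
    (third-on M x∈M y∈M)

same-line-of-two-points : ∀ {x y} L M → On x L → On y L → On x M → On y M → x ≢ y →
  SameLine L M
same-line-of-two-points L M x∈L y∈L x∈M y∈M x≢y z =
  same-line-of-two-points⊆ L M x∈L y∈L x∈M y∈M x≢y z ,
  same-line-of-two-points⊆ M L x∈M y∈M x∈L y∈L x≢y z

another-point : ∀ {x} L → On x L → ∃ λ y → On y L × x ≢ y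
another-point L x∈L with point-surjective L x∈L
... | t , refl = point L (t +₃ 1₃) , point-on L (t +₃ 1₃) , +₃-1₃-≢ t ∘ point-injective L _ _

data Joined (x y : Point) : Set where
  alongFibre : i-of x ≡ i-of y → j-of x ≡ j-of y → Joined x y
  inQ        : i-of x ≡ i-of y → k-of y ≡ k-of x +₃ det (j-of x) (j-of y) → Joined x y
  inR        : j-of x ≡ j-of y → k-of y ≡ k-of x +₃ det (i-of x) (i-of y) → Joined x y

abstract
  transLine-det : ∀ p d a t s →
    proj₂ (gqPoint (transLine p d a) s) ≡
      proj₂ (gqPoint (transLine p d a) t) +₃
        det (proj₁ (gqPoint (transLine p d a) t)) (proj₁ (gqPoint (transLine p d a) s))
  transLine-det = from-yes (allV? λ p → allDir? λ d → all? λ a → all? λ t → all? λ s →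
    proj₂ (gqPoint (transLine p d a) s) ≟
      proj₂ (gqPoint (transLine p d a) t) +₃
        det (proj₁ (gqPoint (transLine p d a) t)) (proj₁ (gqPoint (transLine p d a) s)))

joined : ∀ {x y} L → On x L → On y L → Joined x y
joined L x∈L y∈L with point-surjective L x∈L | point-surjective L y∈L
joined (qLine i (spreadLine u)) _ _ | t , refl | s , refl = alongFibre refl refl
joined (qLine i (transLine p d a)) _ _ | t , refl | s , refl = inQ refl (transLine-det p d a t s)
joined (rLine j (spreadLine u)) _ _ | t , refl | s , refl = alongFibre refl refl
joined (rLine j (transLine p d a)) _ _ | t , refl | s , refl = inR refl (transLine-det p d a t s)

-- Every nonzero vector of AG(2,3) is a multiple of one of the four vectors dirV d.
direction : V → Dir
direction (f0 , _) = d01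
direction (fs f0 , f0) = d10
direction (fs f0 , fs f0) = d11
direction (fs f0 , fs (fs f0)) = d12
direction (fs (fs f0) , f0) = d10
direction (fs (fs f0) , fs f0) = d12
direction (fs (fs f0) , fs (fs f0)) = d11

coefficient : V → Z3
coefficient (f0 , b) = b
coefficient (fs f0 , _) = 1₃
coefficient (fs (fs f0) , _) = 2₃

abstract
  translate-by-zero : ∀ u d → u ≡ u +ᵥ (0₃ ·ᵥ dirV d)
  translate-by-zero = from-yes (allV? λ u → allDir? λ d → u ≟ᵥ u +ᵥ (0₃ ·ᵥ dirV d))

  shift-by-zero : ∀ k e → k ≡ k +₃ 0₃ *₃ e
  shift-by-zero = from-yes (all? λ k → all? λ e → k ≟ k +₃ 0₃ *₃ e)

  along-direction : ∀ u v → u ≢ v →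
    let c = coefficient (v -ᵥ u) ; d = dirV (direction (v -ᵥ u)) in
    (v ≡ u +ᵥ (c ·ᵥ d)) × (det u v ≡ c *₃ det u d)
  along-direction = from-yes (allV? λ u → allV? λ v → ¬? (u ≟ᵥ v) →-dec
    ((v ≟ᵥ u +ᵥ (coefficient (v -ᵥ u) ·ᵥ dirV (direction (v -ᵥ u)))) ×-dec
     (det u v ≟ coefficient (v -ᵥ u) *₃ det u (dirV (direction (v -ᵥ u))))))

on-own-transLine : ∀ p d a → GQOn (p , a) (transLine p d a)
on-own-transLine p d a = 0₃ , translate-by-zero p d , shift-by-zero a (det p (dirV d))

gqLine-through : ∀ u v k → u ≢ v → Σ GQLine λ M → GQOn (u , k) M × GQOn (v , k +₃ det u v) M
gqLine-through u v k u≢v =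
  transLine u (direction (v -ᵥ u)) k , on-own-transLine u (direction (v -ᵥ u)) k ,
  (coefficient (v -ᵥ u) , proj₁ (along-direction u v u≢v) , cong (k +₃_) (proj₂ (along-direction u v u≢v)))

qLine-through : ∀ i u v k → u ≢ v → Σ Line λ L → On (i , u , k) L × On (i , v , k +₃ det u v) L
qLine-through i u v k u≢v with gqLine-through u v k u≢v
... | M , u∈M , v∈M = qLine i M , (refl , u∈M) , (refl , v∈M)

rLine-through : ∀ j u v k → u ≢ v → Σ Line λ L → On (u , j , k) L × On (v , j , k +₃ det u v) L
rLine-through j u v k u≢v with gqLine-through u v k u≢v
... | M , u∈M , v∈M = rLine j M , (refl , u∈M) , (refl , v∈M)

≐-refl : ∀ {A} → A ≐ A
≐-refl x = (λ a → a) , (λ a → a)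

≐-sym : ∀ {A B} → A ≐ B → B ≐ A
≐-sym e x = proj₂ (e x) , proj₁ (e x)

≐-trans : ∀ {A B C} → A ≐ B → B ≐ C → A ≐ C
≐-trans e f x = (λ a → proj₁ (f x) (proj₁ (e x) a)) , (λ c → proj₂ (e x) (proj₂ (f x) c))

LinesAt : PSet → Point → ℕ → Set
LinesAt X x t = Σ (Fin (suc t) → Line) λ ℓ →
  (∀ n → LineIn X (ℓ n) × On x (ℓ n)) ×
  (∀ n m → SameLine (ℓ n) (ℓ m) → n ≡ m) ×
  (∀ L → LineIn X L → On x L → ∃ λ n → SameLine L (ℓ n))

GQAxiomAt : PSet → Point → Line → Set
GQAxiomAt X x L = ∃ λ y → On y L × CollIn X x y × (∀ z → On z L → CollIn X x z → z ≡ y)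

joining-line : ∀ {X x y} → CollIn X x y → Line
joining-line (_ , L , _) = L

joining-line-spec : ∀ {X x y} (x~y : CollIn X x y) → LineIn X (joining-line x~y) × On x (joining-line x~y)
joining-line-spec (_ , _ , L⊆X , x∈L , _) = L⊆X , x∈L

lines-pigeonhole : ∀ {n s} → s < n → (ℓ : Fin n → Line) (m : Fin s → Line) →
  (∀ k → ∃ λ c → SameLine (ℓ k) (m c)) → ∃₂ λ k k′ → k ≢ k′ × SameLine (ℓ k) (ℓ k′)
lines-pigeonhole s<n ℓ m covered with pigeonhole s<n (proj₁ ∘ covered)
... | k , k′ , k<k′ , same-class =
  k , k′ , <⇒≢ k<k′ ,
  ≐-trans (proj₂ (covered k)) (≐-sym (subst (λ c → SameLine (ℓ k′) (m c)) (sym same-class) (proj₂ (covered k′))))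

module _ {A X : PSet} {t : ℕ} (S : SubGQ A X t) where
  open SubGQ S

  lines-at-point-exceed : ∀ {x s} → X x → s < suc t → (m : Fin s → Line) →
    (∀ L → LineIn X L → On x L → ∃ λ k → SameLine L (m k)) → ⊥
  lines-at-point-exceed x∈X s<t+1 m covered with linesAt _ x∈X
  ... | ℓ , ℓ-at-x , ℓ-distinct , _ with lines-pigeonhole s<t+1 ℓ m (λ n → covered (ℓ n) (proj₁ (ℓ-at-x n)) (proj₂ (ℓ-at-x n)))
  ...   | n , n′ , n≢n′ , ℓn~ℓn′ = n≢n′ (ℓ-distinct n n′ ℓn~ℓn′)

  concurrent-lines-coincide : ∀ {x} → X x → (ℓ : Fin (suc (suc t)) → Line) →
    (∀ k → LineIn X (ℓ k) × On x (ℓ k)) → ∃₂ λ k m → k ≢ m × SameLine (ℓ k) (ℓ m)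
  concurrent-lines-coincide x∈X ℓ ℓ-at-x with linesAt _ x∈X
  ... | f , _ , _ , complete = lines-pigeonhole (n<1+n _) ℓ f λ k → complete (ℓ k) (proj₁ (ℓ-at-x k)) (proj₂ (ℓ-at-x k))

  neighbour-on : ∀ {x L} → X x → LineIn X L → ¬ On x L → ∃ λ y → On y L × CollIn X x y
  neighbour-on x∈X L⊆X x∉L with gqAxiom _ _ x∈X L⊆X x∉L
  ... | y , y∈L , x~y , _ = y , y∈L , x~y

  neighbours-not-in-general-position : ∀ {x} → X x → (y : Fin (suc (suc t)) → Point) →
    (∀ k → CollIn X x (y k)) → ¬ (∀ k m → k ≢ m → y k ≢ y m × x ≢ thirdₚ (y k) (y m))
  neighbours-not-in-general-position x∈X y x~y general
    with concurrent-lines-coincide x∈X (joining-line ∘ x~y) (joining-line-spec ∘ x~y)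
  ... | k , m , k≢m , ℓk~ℓm with x~y k | x~y m | general k m k≢m
  ...   | x≢yk , L , _ , x∈L , yk∈L | x≢ym , M , _ , _ , ym∈M | yk≢ym , x≢third =
    x≢third (third-of-distinct L yk∈L (proj₂ (ℓk~ℓm _) ym∈M) x∈L yk≢ym (x≢yk ∘ sym) (x≢ym ∘ sym))

  neighbour-coordinates-not-in-general-position : (c : Point → V) → (∀ x y → c (thirdₚ x y) ≡ third (c x) (c y)) →
    ∀ {x} → X x → (a : Fin (suc (suc t)) → V) → (∀ k → ∃ λ y → CollIn X x y × c y ≡ a k) →
    ¬ (∀ k m → k ≢ m → a k ≢ a m × c x ≢ third (a k) (a m))
  neighbour-coordinates-not-in-general-position c c-third x∈X a y general =
    neighbours-not-in-general-position x∈X (λ k → proj₁ (y k)) (λ k → proj₁ (proj₂ (y k))) λ k m k≢m →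
      (λ yk≡ym → proj₁ (general k m k≢m) (trans (sym (c≡a k)) (trans (cong c yk≡ym) (c≡a m)))) ,
      (λ x≡third → proj₂ (general k m k≢m)
        (trans (cong c x≡third) (trans (c-third _ _) (cong₂ third (c≡a k) (c≡a m)))))
    where
    c≡a : ∀ k → c (proj₁ (y k)) ≡ a k
    c≡a k = proj₂ (proj₂ (y k))

record Automorphism : Set where
  field
    f f⁻¹ : Point → Point
    g g⁻¹ : Line → Line
    f⁻¹∘f : ∀ x → f⁻¹ (f x) ≡ x
    f∘f⁻¹ : ∀ x → f (f⁻¹ x) ≡ x
    g⁻¹∘g : ∀ L → g⁻¹ (g L) ≡ L
    g∘g⁻¹ : ∀ L → g (g⁻¹ L) ≡ L
    f-on : ∀ {x L} → On x L → On (f x) (g L)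
    f⁻¹-on : ∀ {x L} → On x L → On (f⁻¹ x) (g⁻¹ L)

module _ (α : Automorphism) where
  open Automorphism α

  image : PSet → PSet
  image A z = A (f⁻¹ z)

  private
    f-injective : ∀ {x y} → f x ≡ f y → x ≡ y
    f-injective {x} {y} e = trans (sym (f⁻¹∘f x)) (trans (cong f⁻¹ e) (f⁻¹∘f y))

    f⁻¹-injective : ∀ {x y} → f⁻¹ x ≡ f⁻¹ y → x ≡ y
    f⁻¹-injective {x} {y} e = trans (sym (f∘f⁻¹ x)) (trans (cong f e) (f∘f⁻¹ y))

    on-f⁻¹-g : ∀ {x L} → On x (g L) → On (f⁻¹ x) L
    on-f⁻¹-g {L = L} h = subst (On _) (g⁻¹∘g L) (f⁻¹-on h)

    on-f-g⁻¹ : ∀ {x L} → On x (g⁻¹ L) → On (f x) L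
    on-f-g⁻¹ {L = L} h = subst (On _) (g∘g⁻¹ L) (f-on h)

    in-image : ∀ {A x} → A x → image A (f x)
    in-image {A} {x} = subst A (sym (f⁻¹∘f x))

    from-image : ∀ {A x} → image A (f x) → A x
    from-image {A} {x} = subst A (f⁻¹∘f x)

  Collinear-image : ∀ {x y} → Collinear x y → Collinear (f x) (f y)
  Collinear-image (x≢y , L , x∈L , y∈L) = x≢y ∘ f-injective , g L , f-on x∈L , f-on y∈L

  Proj-image : ∀ A {x y} → Proj A x y → Proj (image A) (f x) (f y)
  Proj-image A (inj₁ (x∈A , refl)) = inj₁ (in-image {A} x∈A , refl)
  Proj-image A (inj₂ (x∉A , y∈A , x~y)) =
    inj₂ (x∉A ∘ from-image {A} , in-image {A} y∈A , Collinear-image x~y)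

  ThirdPoint-image : ∀ {x y z} → ThirdPoint x y z → ThirdPoint (f x) (f y) (f z)
  ThirdPoint-image (z≢x , z≢y , L , x∈L , y∈L , z∈L) =
    z≢x ∘ f-injective , z≢y ∘ f-injective , g L , f-on x∈L , f-on y∈L , f-on z∈L

  Refl-image : ∀ A {x z} → Refl A x z → Refl (image A) (f x) (f z)
  Refl-image A (inj₁ (x∈A , refl)) = inj₁ (in-image {A} x∈A , refl)
  Refl-image A (inj₂ (x∉A , y , x↦y , third)) =
    inj₂ (x∉A ∘ from-image {A} , f y , Proj-image A x↦y , ThirdPoint-image third)

  module _ (X : PSet) where
    private
      LineIn-image : ∀ {L} → LineIn X L → LineIn (image X) (g L)
      LineIn-image L⊆X y y∈gL = L⊆X (f⁻¹ y) (on-f⁻¹-g y∈gL)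

      LineIn-preimage : ∀ {L} → LineIn (image X) L → LineIn X (g⁻¹ L)
      LineIn-preimage L⊆fX y y∈L = from-image {X} (L⊆fX (f y) (on-f-g⁻¹ y∈L))

      SameLine-image : ∀ {L M} → SameLine L M → SameLine (g L) (g M)
      SameLine-image L~M y =
        (λ y∈gL → subst (λ z → On z _) (f∘f⁻¹ y) (f-on (proj₁ (L~M _) (on-f⁻¹-g y∈gL)))) ,
        (λ y∈gM → subst (λ z → On z _) (f∘f⁻¹ y) (f-on (proj₂ (L~M _) (on-f⁻¹-g y∈gM))))

      SameLine-preimage : ∀ {L M} → SameLine (g L) (g M) → SameLine L M
      SameLine-preimage gL~gM y =
        (λ y∈L → subst (λ z → On z _) (f⁻¹∘f y) (on-f⁻¹-g (proj₁ (gL~gM _) (f-on y∈L)))) ,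
        (λ y∈M → subst (λ z → On z _) (f⁻¹∘f y) (on-f⁻¹-g (proj₂ (gL~gM _) (f-on y∈M))))

      CollIn-image : ∀ {x y} → CollIn X x y → CollIn (image X) (f x) (f y)
      CollIn-image (x≢y , L , L⊆X , x∈L , y∈L) = x≢y ∘ f-injective , g L , LineIn-image L⊆X , f-on x∈L , f-on y∈L

      CollIn-preimage : ∀ {x y} → CollIn (image X) x y → CollIn X (f⁻¹ x) (f⁻¹ y)
      CollIn-preimage (x≢y , L , L⊆fX , x∈L , y∈L) =
        x≢y ∘ f⁻¹-injective , g⁻¹ L , LineIn-preimage L⊆fX , f⁻¹-on x∈L , f⁻¹-on y∈L

    SubGQ-image : ∀ {A t} → SubGQ A X t → SubGQ (image A) (image X) t
    SubGQ-image {A} {t} S = record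
      { sub = λ z → sub (f⁻¹ z)
      ; nonempty = f (proj₁ nonempty) , in-image {X} (proj₂ nonempty)
      ; linesAt = lines-at
      ; gqAxiom = gq-axiom }
      where
      open SubGQ S
      lines-at : ∀ z → image X z → LinesAt (image X) z t
      lines-at z z∈fX with linesAt (f⁻¹ z) z∈fX
      ... | ℓ , ℓ-at , ℓ-distinct , ℓ-complete =
        (λ n → g (ℓ n)) ,
        (λ n → LineIn-image (proj₁ (ℓ-at n)) , subst (λ w → On w _) (f∘f⁻¹ z) (f-on (proj₂ (ℓ-at n)))) ,
        (λ n m gℓn~gℓm → ℓ-distinct n m (SameLine-preimage gℓn~gℓm)) ,
        λ L L⊆fX z∈L → let (n , g⁻¹L~ℓn) = ℓ-complete (g⁻¹ L) (LineIn-preimage L⊆fX) (f⁻¹-on z∈L) in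
          n , subst (λ K → SameLine K (g (ℓ n))) (g∘g⁻¹ L) (SameLine-image g⁻¹L~ℓn)
      gq-axiom : ∀ z L → image X z → LineIn (image X) L → ¬ On z L → GQAxiomAt (image X) z L
      gq-axiom z L z∈fX L⊆fX z∉L
        with gqAxiom (f⁻¹ z) (g⁻¹ L) z∈fX (LineIn-preimage L⊆fX) (z∉L ∘ subst (λ w → On w L) (f∘f⁻¹ z) ∘ on-f-g⁻¹)
      ... | y , y∈L , z~y , unique =
        f y , on-f-g⁻¹ y∈L , subst (λ w → CollIn (image X) w (f y)) (f∘f⁻¹ z) (CollIn-image z~y) ,
        λ w w∈L z~w → trans (sym (f∘f⁻¹ w)) (cong f (unique (f⁻¹ w) (f⁻¹-on w∈L) (CollIn-preimage z~w)))

shift : Z3 → Point → Point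
shift c (i , j , k) = (i , j , k +₃ c)

shiftGQ : Z3 → GQLine → GQLine
shiftGQ c (spreadLine y) = spreadLine y
shiftGQ c (transLine p d a) = transLine p d (a +₃ c)

shiftLine : Z3 → Line → Line
shiftLine c (qLine i M) = qLine i (shiftGQ c M)
shiftLine c (rLine j M) = rLine j (shiftGQ c M)

shift-on : ∀ c {x} L → On x L → On (shift c x) (shiftLine c L)
shift-on c (qLine i (spreadLine y)) x∈L = x∈L
shift-on c (qLine i (transLine p d a)) (refl , s , refl , refl) = refl , s , refl , +₃-swapʳ a _ c
shift-on c (rLine j (spreadLine y)) x∈L = x∈L
shift-on c (rLine j (transLine p d a)) (refl , s , refl , refl) = refl , s , refl , +₃-swapʳ a _ c

shift-cancel : ∀ c c′ → (∀ k → (k +₃ c) +₃ c′ ≡ k) → ∀ x → shift c′ (shift c x) ≡ x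
shift-cancel c c′ cancel (i , j , k) = cong (λ l → (i , j , l)) (cancel k)

shiftLine-cancel : ∀ c c′ → (∀ k → (k +₃ c) +₃ c′ ≡ k) → ∀ L → shiftLine c′ (shiftLine c L) ≡ L
shiftLine-cancel c c′ cancel (qLine i (spreadLine y)) = refl
shiftLine-cancel c c′ cancel (qLine i (transLine p d a)) = cong (qLine i ∘ transLine p d) (cancel a)
shiftLine-cancel c c′ cancel (rLine j (spreadLine y)) = refl
shiftLine-cancel c c′ cancel (rLine j (transLine p d a)) = cong (rLine j ∘ transLine p d) (cancel a)

shiftAut : Z3 → Automorphism
shiftAut c = record
  { f = shift c ; f⁻¹ = shift (-₃ c) ; g = shiftLine c ; g⁻¹ = shiftLine (-₃ c)
  ; f⁻¹∘f = shift-cancel c (-₃ c) (λ k → k+c-c≡k k c)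
  ; f∘f⁻¹ = shift-cancel (-₃ c) c (λ k → k-c+c≡k k c)
  ; g⁻¹∘g = shiftLine-cancel c (-₃ c) (λ k → k+c-c≡k k c)
  ; g∘g⁻¹ = shiftLine-cancel (-₃ c) c (λ k → k-c+c≡k k c)
  ; f-on = shift-on c _
  ; f⁻¹-on = shift-on (-₃ c) _ }

swap : Point → Point
swap (i , j , k) = (j , i , k)

swapLine : Line → Line
swapLine (qLine i M) = rLine i M
swapLine (rLine j M) = qLine j M

swapLine-involutive : ∀ L → swapLine (swapLine L) ≡ L
swapLine-involutive (qLine i M) = refl
swapLine-involutive (rLine j M) = refl

swap-on : ∀ {x} L → On x L → On (swap x) (swapLine L)
swap-on (qLine i M) x∈L = x∈L
swap-on (rLine j M) x∈L = x∈L

swapAut : Automorphism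
swapAut = record
  { f = swap ; f⁻¹ = swap ; g = swapLine ; g⁻¹ = swapLine
  ; f⁻¹∘f = λ _ → refl ; f∘f⁻¹ = λ _ → refl
  ; g⁻¹∘g = swapLine-involutive ; g∘g⁻¹ = swapLine-involutive
  ; f-on = swap-on _ ; f⁻¹-on = swap-on _ }

projR : V → Point → Point
projR j (i , j′ , k) = (i , j , k +₃ det j′ j)

projQ : V → Point → Point
projQ i (i′ , j , k) = (i , j , k +₃ det i′ i)

projR-fixes : ∀ {x} j → j-of x ≡ j → projR j x ≡ x
projR-fixes {i , j , k} j refl = cong (λ l → (i , j , l)) (trans (cong (k +₃_) (det-self j)) (+₃-identityʳ k))

Proj-projR : ∀ j x → Proj (Rc j) x (projR j x)
Proj-projR j x@(i , j′ , k) with j′ ≟ᵥ j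
... | yes refl = inj₁ (refl , projR-fixes {x} j refl)
... | no j′≢j = inj₂ (j′≢j , refl , (λ e → j′≢j (cong j-of e)) , qLine-through i j′ j k j′≢j)

Proj-projQ : ∀ i x → i-of x ≢ i → Proj (Qc i) x (projQ i x)
Proj-projQ i (i′ , j , k) i′≢i = inj₂ (i′≢i , refl , (λ e → i′≢i (cong i-of e)) , rLine-through j i′ i k i′≢i)

Proj-Rc-unique : ∀ j {x y} → Proj (Rc j) x y → y ≡ projR j x
Proj-Rc-unique j (inj₁ (x∈R , refl)) = sym (projR-fixes j x∈R)
Proj-Rc-unique j {x} {y} (inj₂ (x∉R , refl , _ , L , x∈L , y∈L)) with joined L x∈L y∈L
... | alongFibre _ j≡ = ⊥-elim (x∉R j≡)
... | inR j≡ _ = ⊥-elim (x∉R j≡)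
... | inQ i≡ k≡ = cong₂ (λ i k → (i , j-of y , k)) (sym i≡) k≡

fibre : Point → Line
fibre (i , j , _) = qLine i (spreadLine j)

on-fibre : ∀ x → On x (fibre x)
on-fibre x = refl , refl

fibre-neighbour : ∀ {X x} → LineIn X (fibre x) → CollIn X x (shift 1₃ x)
fibre-neighbour {x = x} fibre⊆X =
  (λ e → +₃-1₃-≢ (k-of x) (cong k-of e)) , fibre x , fibre⊆X , on-fibre x , (refl , refl)

abstract
  general-position-off-line : ∀ v q q̄ → q ≢ q̄ → v ≢ q → v ≢ q̄ → v ≢ third q q̄ →
    let a = lookup (v ∷ q ∷ q̄ ∷ third q q̄ ∷ []) in
    ∀ k m → k ≢ m → a k ≢ a m × v ≢ third (a k) (a m)
  general-position-off-line = from-yes (allV? λ v → allV? λ q → allV? λ q̄ →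
    ¬? (q ≟ᵥ q̄) →-dec (¬? (v ≟ᵥ q) →-dec (¬? (v ≟ᵥ q̄) →-dec (¬? (v ≟ᵥ third q q̄) →-dec
    (all? λ k → all? λ m → ¬? (k ≟ m) →-dec
      (¬? (lookup (v ∷ q ∷ q̄ ∷ third q q̄ ∷ []) k ≟ᵥ lookup (v ∷ q ∷ q̄ ∷ third q q̄ ∷ []) m) ×-dec
       ¬? (v ≟ᵥ third (lookup (v ∷ q ∷ q̄ ∷ third q q̄ ∷ []) k) (lookup (v ∷ q ∷ q̄ ∷ third q q̄ ∷ []) m))))))))

  third-det : ∀ q q̄ → -₃ (0₃ +₃ (0₃ +₃ det q q̄)) ≡ 0₃ +₃ det q (third q q̄)
  third-det = from-yes (allV? λ q → allV? λ q̄ → -₃ (0₃ +₃ (0₃ +₃ det q q̄)) ≟ 0₃ +₃ det q (third q q̄))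

-- A W(2)-subquadrangle of R_j which is a union of fibres cannot meet the three
-- fibres over the line {q, q̄, third q q̄} of AG(2,3).
module FibredW2 (j q q̄ : V) (q≢q̄ : q ≢ q̄) (X : PSet) (X-W2 : IsW2Sub (Rc j) X)
  (X-shift : ∀ c {z} → X z → X (shift c z))
  (meets-fibre-over : ∀ a → a ≡ q ⊎ a ≡ q̄ ⊎ a ≡ third q q̄ → ∃ λ p → X p × i-of p ≡ a) where

  open SubGQ X-W2

  fibre-closed : ∀ {x} → X x → ∀ k → X (i-of x , j-of x , k)
  fibre-closed {x} x∈X k = subst (λ l → X (i-of x , j-of x , l)) (+₃-sub (k-of x) k) (X-shift (k -₃ k-of x) x∈X)

  fibre⊆X : ∀ {x} → X x → LineIn X (fibre x)
  fibre⊆X x∈X (_ , _ , k) (refl , refl) = fibre-closed x∈X k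

  neighbour-over : ∀ {x} a → a ≡ q ⊎ a ≡ q̄ ⊎ a ≡ third q q̄ → X x → i-of x ≢ a →
    ∃ λ y → CollIn X x y × i-of y ≡ a
  neighbour-over a a∈ℓ x∈X i≢a with meets-fibre-over a a∈ℓ
  ... | p , p∈X , refl with neighbour-on X-W2 {L = fibre p} x∈X (fibre⊆X p∈X) (i≢a ∘ proj₁)
  ... | y , (i≡ , _) , x~y = y , x~y , i≡

  -- Through a point off the line there would be four lines of X: its fibre and
  -- one line towards each of the three fibres over the line.
  off-line-absurd : ∀ {x} → X x → i-of x ≢ q → i-of x ≢ q̄ → i-of x ≢ third q q̄ → ⊥
  off-line-absurd {x} x∈X x≢q x≢q̄ x≢a₃ =
    neighbour-coordinates-not-in-general-position X-W2 i-of (λ _ _ → refl) x∈X _ neighbour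
      (general-position-off-line (i-of x) q q̄ q≢q̄ x≢q x≢q̄ x≢a₃)
    where
    neighbour : ∀ k → ∃ λ y → CollIn X x y × i-of y ≡ lookup (i-of x ∷ q ∷ q̄ ∷ third q q̄ ∷ []) k
    neighbour f0 = shift 1₃ x , fibre-neighbour (fibre⊆X x∈X) , refl
    neighbour (fs f0) = neighbour-over q (inj₁ refl) x∈X x≢q
    neighbour (fs (fs f0)) = neighbour-over q̄ (inj₂ (inj₁ refl)) x∈X x≢q̄
    neighbour (fs (fs (fs f0))) = neighbour-over (third q q̄) (inj₂ (inj₂ refl)) x∈X x≢a₃

  g : Point
  g = (q , j , 0₃)

  g∈X : X g
  g∈X with meets-fibre-over q (inj₁ refl)
  ... | p , p∈X , refl = subst (λ j′ → X (i-of p , j′ , 0₃)) (sub p p∈X) (fibre-closed p∈X 0₃)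

  transversal : Line
  transversal = proj₁ (rLine-through j q q̄ 0₃ q≢q̄)

  g∈transversal : On g transversal
  g∈transversal = proj₁ (proj₂ (rLine-through j q q̄ 0₃ q≢q̄))

  over-on-transversal : ∀ a → a ≡ q̄ ⊎ a ≡ third q q̄ → On (a , j , 0₃ +₃ det q a) transversal
  over-on-transversal _ (inj₁ refl) = proj₂ (proj₂ (rLine-through j q q̄ 0₃ q≢q̄))
  over-on-transversal _ (inj₂ refl) =
    subst (λ z → On z transversal) (cong₂ (λ j′ k → (third q q̄ , j′ , k)) (third-self j) (third-det q q̄))
      (third-on transversal g∈transversal (over-on-transversal q̄ (inj₁ refl)))

  candidates : Fin 2 → Line
  candidates = lookup (fibre g ∷ transversal ∷ [])

  line-through-g : ∀ L → LineIn X L → On g L → ∃ λ n → SameLine L (candidates n)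
  line-through-g L L⊆X g∈L with another-point L g∈L
  ... | y , y∈L , g≢y = classify (L⊆X y y∈L)
    where
    joins-transversal : X y → i-of y ≢ q → i-of y ≡ q̄ ⊎ i-of y ≡ third q q̄ → SameLine L transversal
    joins-transversal y∈X y≢q y∈ℓ =
      same-line-of-two-points L transversal g∈L y∈L g∈transversal y∈T g≢y
      where
      y∈T : On y transversal
      y∈T with joined L g∈L y∈L
      ... | alongFibre q≡ _ = ⊥-elim (y≢q (sym q≡))
      ... | inQ q≡ _ = ⊥-elim (y≢q (sym q≡))
      ... | inR _ k≡ = subst (λ z → On z transversal)
            (cong₂ (λ j′ k → (i-of y , j′ , k)) (sym (sub y y∈X)) (sym k≡))
            (over-on-transversal (i-of y) y∈ℓ)
    classify : X y → ∃ λ n → SameLine L (candidates n)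
    classify y∈X with i-of y ≟ᵥ q | i-of y ≟ᵥ q̄ | i-of y ≟ᵥ third q q̄
    ... | yes y≡q | _ | _ = f0 , same-line-of-two-points L (fibre g) g∈L y∈L (on-fibre g) (y≡q , sub y y∈X) g≢y
    ... | no y≢q | no y≢q̄ | no y≢a₃ = ⊥-elim (off-line-absurd y∈X y≢q y≢q̄ y≢a₃)
    ... | no y≢q | yes y≡q̄ | _ = fs f0 , joins-transversal y∈X y≢q (inj₁ y≡q̄)
    ... | no y≢q | no _ | yes y≡a₃ = fs f0 , joins-transversal y∈X y≢q (inj₂ y≡a₃)

  -- Hence X lies over the line, where only two lines pass through g.
  absurd : ⊥
  absurd = lines-at-point-exceed X-W2 g∈X (s≤s (s≤s (s≤s z≤n))) candidates line-through-g

-- π_{R_{j*}} ∘ π_{R_{j₂}} ∘ π_{R_{j₁}} shifts R_{j*} along its fibres by this amount.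
loopShift : V → V → V → Z3
loopShift j* j₁ j₂ = det j* j₁ +₃ det j₁ j₂ +₃ det j₂ j*

projR-loop : ∀ j* j₁ j₂ {x} → j-of x ≡ j* →
  projR j* (projR j₂ (projR j₁ x)) ≡ shift (loopShift j* j₁ j₂) x
projR-loop j* j₁ j₂ {i , _ , k} refl = cong (λ l → (i , j* , l)) (+₃-assoc₄ k _ _ _)

shifted : Z3 → PSet → PSet
shifted c = image (shiftAut c)

shifted-cong : ∀ c {X Y} → X ≐ Y → shifted c X ≐ shifted c Y
shifted-cong c X≐Y z = X≐Y (shift (-₃ c) z)

abstract
  -₃-distrib-+₃ : ∀ k c c′ → (k +₃ (-₃ c)) +₃ (-₃ c′) ≡ k +₃ (-₃ (c +₃ c′))
  -₃-distrib-+₃ = from-yes (all? λ k → all? λ c → all? λ c′ → (k +₃ (-₃ c)) +₃ (-₃ c′) ≟ k +₃ (-₃ (c +₃ c′)))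

  k-0≡k : ∀ k → k +₃ (-₃ 0₃) ≡ k
  k-0≡k = from-yes (all? λ k → k +₃ (-₃ 0₃) ≟ k)

shifted-+ : ∀ c c′ X → shifted c (shifted c′ X) ≐ shifted (c +₃ c′) X
shifted-+ c c′ X (i , j , k) = subst X eq , subst X (sym eq)
  where
  eq : (i , j , (k +₃ (-₃ c)) +₃ (-₃ c′)) ≡ (i , j , k +₃ (-₃ (c +₃ c′)))
  eq = cong (λ l → (i , j , l)) (-₃-distrib-+₃ k c c′)

shifted-0 : ∀ X → shifted 0₃ X ≐ X
shifted-0 X (i , j , k) = subst X eq , subst X (sym eq)
  where
  eq : (i , j , k +₃ (-₃ 0₃)) ≡ (i , j , k)
  eq = cong (λ l → (i , j , l)) (k-0≡k k)

fromValues : Z3 → Z3 → Z3 → Z3 → Z3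
fromValues a b c f0 = a
fromValues a b c (fs f0) = b
fromValues a b c (fs (fs f0)) = c

abstract
  fromValues-cube-identity : ∀ a b c → (∀ n → fromValues a b c (fromValues a b c (fromValues a b c n)) ≡ n) →
    ∀ n → fromValues a b c n ≡ n +₃ a
  fromValues-cube-identity = from-yes (all? λ a → all? λ b → all? λ c →
    (all? λ n → fromValues a b c (fromValues a b c (fromValues a b c n)) ≟ n) →-dec
    (all? λ n → fromValues a b c n ≟ n +₃ a))

cube-identity⇒translation : (ρ : Z3 → Z3) → (∀ n → ρ (ρ (ρ n)) ≡ n) → ∀ n → ρ n ≡ n +₃ ρ 0₃
cube-identity⇒translation ρ ρ³≡id n =
  trans (ρ≡table n) (fromValues-cube-identity (ρ 0₃) (ρ 1₃) (ρ 2₃) table³≡id n)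
  where
  table = fromValues (ρ 0₃) (ρ 1₃) (ρ 2₃)
  ρ≡table : ∀ n → ρ n ≡ table n
  ρ≡table f0 = refl
  ρ≡table (fs f0) = refl
  ρ≡table (fs (fs f0)) = refl
  table³≡id : ∀ n → table (table (table n)) ≡ n
  table³≡id n = trans (sym (trans (ρ≡table (ρ (ρ n)))
    (trans (cong table (ρ≡table (ρ n))) (cong (table ∘ table) (ρ≡table n))))) (ρ³≡id n)

abstract
  multiples : ∀ n t → (n ≡ n +₃ 0₃ *₃ t) × (n +₃ t ≡ n +₃ 1₃ *₃ t) × ((n +₃ t) +₃ t ≡ n +₃ 2₃ *₃ t)
  multiples = from-yes (all? λ n → all? λ t →
    (n ≟ n +₃ 0₃ *₃ t) ×-dec ((n +₃ t ≟ n +₃ 1₃ *₃ t) ×-dec ((n +₃ t) +₃ t ≟ n +₃ 2₃ *₃ t)))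

  +₃-identityˡ : ∀ a → 0₃ +₃ a ≡ a
  +₃-identityˡ = from-yes (all? λ a → 0₃ +₃ a ≟ a)

abstract
  c*0≡0 : ∀ c → 0₃ +₃ c *₃ 0₃ ≡ 0₃
  c*0≡0 = from-yes (all? λ c → 0₃ +₃ c *₃ 0₃ ≟ 0₃)

  third-distinct : ∀ u v → u ≢ v → third u v ≢ u × third u v ≢ v
  third-distinct = from-yes (allV? λ u → allV? λ v → ¬? (u ≟ᵥ v) →-dec
    (¬? (third u v ≟ᵥ u) ×-dec ¬? (third u v ≟ᵥ v)))

module TrueCase (iQ iQ̄ jL* : V) where
  open Setting true iQ iQ̄ jL* public

  Φ-R*⇒shift : ∀ j₁ j₂ {x z} → R* x → Φ j₁ j₂ x z → z ≡ shift (loopShift jL* j₁ j₂) x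
  Φ-R*⇒shift j₁ j₂ {x} x∈R* (y₁ , y₂ , x↦y₁ , y₁↦y₂ , y₂↦z) =
    trans (Proj-Rc-unique jL* y₂↦z)
      (trans (cong (projR jL*) (trans (Proj-Rc-unique j₂ y₁↦y₂) (cong (projR j₂) (Proj-Rc-unique j₁ x↦y₁))))
        (projR-loop jL* j₁ j₂ {x} x∈R*))

  Φ-shift : ∀ j₁ j₂ {x} → R* x → Φ j₁ j₂ x (shift (loopShift jL* j₁ j₂) x)
  Φ-shift j₁ j₂ {x} x∈R* =
    projR j₁ x , projR j₂ (projR j₁ x) , Proj-projR j₁ x , Proj-projR j₂ _ ,
    subst (Proj R* _) (projR-loop jL* j₁ j₂ {x} x∈R*) (Proj-projR jL* _)

  image-Φ : ∀ j₁ j₂ X → X ⊆ R* → ImageR (Φ j₁ j₂) X ≐ shifted (loopShift jL* j₁ j₂) X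
  image-Φ j₁ j₂ X X⊆R* z = to , from
    where
    open Automorphism (shiftAut (loopShift jL* j₁ j₂))
    to : ImageR (Φ j₁ j₂) X z → shifted (loopShift jL* j₁ j₂) X z
    to (x , x∈X , x↦z) with Φ-R*⇒shift j₁ j₂ (X⊆R* x x∈X) x↦z
    ... | refl = subst X (sym (f⁻¹∘f x)) x∈X
    from : shifted (loopShift jL* j₁ j₂) X z → ImageR (Φ j₁ j₂) X z
    from z∈ = f⁻¹ z , z∈ , subst (Φ j₁ j₂ (f⁻¹ z)) (f∘f⁻¹ z) (Φ-shift j₁ j₂ (X⊆R* _ z∈))

  G*-shift : ∀ c {z} → G* z → G* (shift c z)
  G*-shift c (z∈R* , inj₁ z∈Q) = z∈R* , inj₁ z∈Q
  G*-shift c (z∈R* , inj₂ (inj₁ z∈Q̄)) = z∈R* , inj₂ (inj₁ z∈Q̄)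
  G*-shift c (z∈R* , inj₂ (inj₂ (x , x∈Q̄ , x↦z))) =
    z∈R* , inj₂ (inj₂ (shift c x , x∈Q̄ , Refl-image (shiftAut c) Q x↦z))

  -- The witness is the reflection R_Q of (iQ̄ , jL* , 0).
  G*-over-third : iQ ≢ iQ̄ → ∃ λ z → G* z × i-of z ≡ third iQ iQ̄
  G*-over-third iQ≢iQ̄ = thirdₚ x̄ ȳ , (third-self jL* , inj₂ (inj₂ (x̄ , refl , x̄↦z̿))) , third-comm iQ̄ iQ
    where
    iQ̄≢iQ : iQ̄ ≢ iQ
    iQ̄≢iQ = iQ≢iQ̄ ∘ sym
    x̄ ȳ : Point
    x̄ = (iQ̄ , jL* , 0₃)
    ȳ = projQ iQ x̄
    x̄ȳ = rLine-through jL* iQ̄ iQ 0₃ iQ̄≢iQ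
    x̄↦z̿ : Refl Q x̄ (thirdₚ x̄ ȳ)
    x̄↦z̿ = inj₂ (iQ̄≢iQ , ȳ , Proj-projQ iQ x̄ iQ̄≢iQ ,
      (proj₁ (third-distinct iQ̄ iQ iQ̄≢iQ) ∘ cong i-of) , (proj₂ (third-distinct iQ̄ iQ iQ̄≢iQ) ∘ cong i-of) ,
      proj₁ x̄ȳ , proj₁ (proj₂ x̄ȳ) , proj₂ (proj₂ x̄ȳ) , third-on (proj₁ x̄ȳ) (proj₁ (proj₂ x̄ȳ)) (proj₂ (proj₂ x̄ȳ)))

  module Indexed (W : Z3 → PSet) (idx : IsIndexing W) where
    W-sub : ∀ n → W n ⊆ R*
    W-sub n = SubGQ.sub (proj₁ (proj₁ idx n))

    W-injective : ∀ n m → W n ≐ W m → n ≡ m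
    W-injective = proj₁ (proj₂ idx)

    W-cong : ∀ {n m} → n ≡ m → W n ≐ W m
    W-cong refl = ≐-refl

    shift-permutes : ∀ c n → ∃ λ m → shifted c (W n) ≐ W m
    shift-permutes c n = proj₂ (proj₂ idx) _ (SubGQ-image (shiftAut c) (W n) (proj₁ (proj₁ idx n)))
      (λ z z∈G* → proj₂ (proj₁ idx n) _ (G*-shift (-₃ c) z∈G*))

    ρ : Z3 → Z3
    ρ n = proj₁ (shift-permutes 1₃ n)

    ρ-spec : ∀ n → shifted 1₃ (W n) ≐ W (ρ n)
    ρ-spec n = proj₂ (shift-permutes 1₃ n)

    ρ³≡id : ∀ n → ρ (ρ (ρ n)) ≡ n
    ρ³≡id n = W-injective _ _
      (≐-trans (≐-sym (ρ-spec (ρ (ρ n))))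
      (≐-trans (shifted-cong 1₃ (≐-sym (ρ-spec (ρ n))))
      (≐-trans (shifted-cong 1₃ (shifted-cong 1₃ (≐-sym (ρ-spec n))))
      (≐-trans (shifted-cong 1₃ (shifted-+ 1₃ 1₃ (W n)))
      (≐-trans (shifted-+ 1₃ 2₃ (W n))
      (shifted-0 (W n)))))))

    step : Z3
    step = ρ 0₃

    ρ≡+step : ∀ n → ρ n ≡ n +₃ step
    ρ≡+step = cube-identity⇒translation ρ ρ³≡id

    shifted-W : ∀ c n → shifted c (W n) ≐ W (n +₃ c *₃ step)
    shifted-W f0 n = ≐-trans (shifted-0 (W n)) (W-cong (proj₁ (multiples n step)))
    shifted-W (fs f0) n = ≐-trans (ρ-spec n) (W-cong (trans (ρ≡+step n) (proj₁ (proj₂ (multiples n step)))))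
    shifted-W (fs (fs f0)) n =
      ≐-trans (≐-sym (shifted-+ 1₃ 1₃ (W n)))
      (≐-trans (shifted-cong 1₃ (ρ-spec n))
      (≐-trans (ρ-spec (ρ n))
      (W-cong (trans (ρ≡+step (ρ n)) (trans (cong (_+₃ step) (ρ≡+step n)) (proj₂ (proj₂ (multiples n step))))))))

    θ₀ : V → V → Z3
    θ₀ j₁ j₂ = loopShift jL* j₁ j₂ *₃ step

    θ₀-IsTheta : ∀ j₁ j₂ → IsTheta W j₁ j₂ (θ₀ j₁ j₂)
    θ₀-IsTheta j₁ j₂ n = ≐-trans (image-Φ j₁ j₂ (W n) (W-sub n)) (shifted-W (loopShift jL* j₁ j₂) n)

    IsTheta-unique : ∀ {j₁ j₂ θ} → IsTheta W j₁ j₂ θ → θ ≡ θ₀ j₁ j₂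
    IsTheta-unique {j₁} {j₂} {θ} isθ = trans (sym (+₃-identityˡ θ))
      (trans (W-injective _ _ (≐-trans (≐-sym (isθ 0₃)) (θ₀-IsTheta j₁ j₂ 0₃))) (+₃-identityˡ _))

    W₀-shift-invariant : step ≡ 0₃ → ∀ c {z} → W 0₃ z → W 0₃ (shift c z)
    W₀-shift-invariant step≡0 c {z} z∈W₀ =
      proj₁ (≐-trans (shifted-W c 0₃) (W-cong (trans (cong (λ t → 0₃ +₃ c *₃ t) step≡0) (c*0≡0 c))) (shift c z))
        (subst (W 0₃) (sym (Automorphism.f⁻¹∘f (shiftAut c) z)) z∈W₀)

    -- For step = 0, W⁰ would be a union of fibres of R* containing G*.
    step≢0 : iQ ≢ iQ̄ → step ≢ 0₃
    step≢0 iQ≢iQ̄ step≡0 =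
      FibredW2.absurd jL* iQ iQ̄ iQ≢iQ̄ (W 0₃) (proj₁ (proj₁ idx 0₃)) (W₀-shift-invariant step≡0) meets
      where
      G*⊆W₀ : G* ⊆ W 0₃
      G*⊆W₀ = proj₂ (proj₁ idx 0₃)
      meets : ∀ a → a ≡ iQ ⊎ a ≡ iQ̄ ⊎ a ≡ third iQ iQ̄ → ∃ λ p → W 0₃ p × i-of p ≡ a
      meets _ (inj₁ refl) = (iQ , jL* , 0₃) , G*⊆W₀ _ (refl , inj₁ refl) , refl
      meets _ (inj₂ (inj₁ refl)) = (iQ̄ , jL* , 0₃) , G*⊆W₀ _ (refl , inj₂ (inj₁ refl)) , refl
      meets _ (inj₂ (inj₂ refl)) with G*-over-third iQ≢iQ̄
      ... | z , z∈G* , refl = z , G*⊆W₀ z z∈G* , refl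

-- area a b c = det (b - a) (c - a) vanishes exactly when a, b, c lie on a common
-- line of AG(2,3), in particular when two of them coincide.
area : V → V → V → Z3
area a b c = det a b +₃ det b c +₃ det c a

abstract
  general-position-noncollinear : ∀ a b c → area a b c ≢ 0₃ →
    let v = lookup (a ∷ b ∷ c ∷ []) in ∀ k m → k ≢ m → v k ≢ v m × a ≢ third (v k) (v m)
  general-position-noncollinear = from-yes (allV? λ a → allV? λ b → allV? λ c → ¬? (area a b c ≟ 0₃) →-dec
    (all? λ k → all? λ m → ¬? (k ≟ m) →-dec
      (¬? (lookup (a ∷ b ∷ c ∷ []) k ≟ᵥ lookup (a ∷ b ∷ c ∷ []) m) ×-dec
       ¬? (a ≟ᵥ third (lookup (a ∷ b ∷ c ∷ []) k) (lookup (a ∷ b ∷ c ∷ []) m)))))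

module _ (iQ iQ̄ jL* : V) where
  open Setting true iQ iQ̄ jL*

  InGrid⇒area≡0 : ∀ j₁ j₂ j₃ → InGrid j₁ j₂ j₃ → area j₁ j₂ j₃ ≡ 0₃
  InGrid⇒area≡0 j₁ j₂ j₃ (X , X-grid , ℓ₁⊆X , ℓ₂⊆X , ℓ₃⊆X) with area j₁ j₂ j₃ ≟ 0₃
  ... | yes area≡0 = area≡0
  ... | no area≢0 =
    ⊥-elim (neighbour-coordinates-not-in-general-position X-grid j-of (λ _ _ → refl) x∈X _ neighbour general)
    where
    general = general-position-noncollinear j₁ j₂ j₃ area≢0
    x : Point
    x = (iQ , j₁ , 0₃)
    x∈X : X x
    x∈X = ℓ₁⊆X x (refl , refl)
    via-fibre : ∀ j → S-line j ⊆ X → j₁ ≢ j → ∃ λ y → CollIn X x y × j-of y ≡ j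
    via-fibre j ℓ⊆X j₁≢j with neighbour-on X-grid {L = qLine iQ (spreadLine j)} x∈X ℓ⊆X (j₁≢j ∘ proj₂)
    ... | y , (_ , j≡) , x~y = y , x~y , j≡
    neighbour : ∀ k → ∃ λ y → CollIn X x y × j-of y ≡ lookup (j₁ ∷ j₂ ∷ j₃ ∷ []) k
    neighbour f0 = shift 1₃ x , fibre-neighbour ℓ₁⊆X , refl
    neighbour (fs f0) = via-fibre j₂ ℓ₂⊆X (proj₁ (general f0 (fs f0) λ ()))
    neighbour (fs (fs f0)) = via-fibre j₃ ℓ₃⊆X (proj₁ (general f0 (fs (fs f0)) λ ()))

abstract
  translate-+ : ∀ u d s t → (u +ᵥ (s ·ᵥ dirV d)) +ᵥ (t ·ᵥ dirV d) ≡ u +ᵥ ((s +₃ t) ·ᵥ dirV d)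
  translate-+ = from-yes (allV? λ u → allDir? λ d → all? λ s → all? λ t →
    (u +ᵥ (s ·ᵥ dirV d)) +ᵥ (t ·ᵥ dirV d) ≟ᵥ u +ᵥ ((s +₃ t) ·ᵥ dirV d))

  translate-by-one-≢ : ∀ v d → v +ᵥ (1₃ ·ᵥ dirV d) ≢ v
  translate-by-one-≢ = from-yes (allV? λ v → allDir? λ d → ¬? (v +ᵥ (1₃ ·ᵥ dirV d) ≟ᵥ v))

  translate-difference : ∀ u d s s′ →
    let v = u +ᵥ (s ·ᵥ dirV d) ; v′ = u +ᵥ (s′ ·ᵥ dirV d) in
    (v′ ≡ v +ᵥ ((s′ -₃ s) ·ᵥ dirV d)) × (det v v′ ≡ (s′ -₃ s) *₃ det v (dirV d))
  translate-difference = from-yes (allV? λ u → allDir? λ d → all? λ s → all? λ s′ →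
    (u +ᵥ (s′ ·ᵥ dirV d) ≟ᵥ (u +ᵥ (s ·ᵥ dirV d)) +ᵥ ((s′ -₃ s) ·ᵥ dirV d)) ×-dec
    (det (u +ᵥ (s ·ᵥ dirV d)) (u +ᵥ (s′ ·ᵥ dirV d)) ≟ (s′ -₃ s) *₃ det (u +ᵥ (s ·ᵥ dirV d)) (dirV d)))

  transLine-back : ∀ p d k a →
    let (p′ , k′) = gqPoint (transLine p d k) a in gqPoint (transLine p′ d k′) (-₃ a) ≡ (p , k)
  transLine-back = from-yes (allV? λ p → allDir? λ d → all? λ k → all? λ a →
    ≡-dec _≟ᵥ_ _≟_ (gqPoint (transLine (proj₁ (gqPoint (transLine p d k) a)) d (proj₂ (gqPoint (transLine p d k) a))) (-₃ a))
      (p , k))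

-- The grid of Q_i over the line u + Z3 d of AG(2,3): its lines are the fibres
-- and the lines of Q_i in direction d.
module AffineGrid (i u : V) (d : Dir) where

  OnAffineLine : V → Set
  OnAffineLine v = ∃ λ s → v ≡ u +ᵥ (s ·ᵥ dirV d)

  record X (x : Point) : Set where
    constructor member
    field
      over-i : i-of x ≡ i
      over-line : OnAffineLine (j-of x)
  open X

  along : Point → Line
  along (i′ , j , k) = qLine i′ (transLine j d k)

  on-along : ∀ x → On x (along x)
  on-along (i′ , j , k) = refl , on-own-transLine j d k

  along-symmetric : ∀ {x z} → On z (along x) → On x (along z)
  along-symmetric {i′ , j , k} {z} (refl , a , refl , refl) =
    subst (λ g → On (i′ , g) (along z)) (transLine-back j d k a) (point-on (along z) (-₃ a))

  same-along : ∀ {x z} → On z (along x) → SameLine (along x) (along z)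
  same-along {x} {z} z∈x with x ≟ₚ z
  ... | yes refl = ≐-refl
  ... | no x≢z = same-line-of-two-points (along x) (along z) (on-along x) z∈x (along-symmetric z∈x) (on-along z) x≢z

  fibre⊆X : ∀ {x} → X x → LineIn X (fibre x)
  fibre⊆X (member i≡ on) _ (refl , refl) = member i≡ on

  along⊆X : ∀ {x} → X x → LineIn X (along x)
  along⊆X (member i≡ (s , refl)) _ (refl , t , refl , _) = member i≡ (s +₃ t , translate-+ u d s t)

  along-reaches : ∀ {x w} → X x → X w → ∃ λ a → j-of (point (along x) a) ≡ j-of w
  along-reaches (member _ (s , refl)) (member _ (s′ , refl)) = s′ -₃ s , sym (proj₁ (translate-difference u d s s′))

  along-injective : ∀ x a b → j-of (point (along x) a) ≡ j-of (point (along x) b) → a ≡ b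
  along-injective x = translate-injective (j-of x) d

  fibre≁along : ∀ x → ¬ SameLine (fibre x) (along x)
  fibre≁along x fibre~along =
    translate-by-one-≢ (j-of x) d (proj₂ (proj₂ (fibre~along _) (point-on (along x) 1₃)))

  joined-in-Q : ∀ {x y} → X x → X y → i-of x ≡ i-of y → k-of y ≡ k-of x +₃ det (j-of x) (j-of y) → On y (along x)
  joined-in-Q {x} (member _ (s , refl)) (member _ (s′ , refl)) i≡ k≡ =
    sym i≡ , s′ -₃ s , proj₁ (translate-difference u d s s′) ,
    trans k≡ (cong (k-of x +₃_) (proj₂ (translate-difference u d s s′)))

  classify : ∀ {x L} → X x → LineIn X L → On x L → SameLine L (fibre x) ⊎ SameLine L (along x)
  classify {x} {L} x∈X L⊆X x∈L with another-point L x∈L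
  ... | y , y∈L , x≢y with L⊆X y y∈L | j-of y ≟ᵥ j-of x
  ...   | y∈X | yes j≡ = inj₁ (same-line-of-two-points L (fibre x) x∈L y∈L (on-fibre x)
                                 (trans (over-i y∈X) (sym (over-i x∈X)) , j≡) x≢y)
  ...   | y∈X | no j≢ with joined L x∈L y∈L
  ...     | alongFibre _ j≡ = ⊥-elim (j≢ (sym j≡))
  ...     | inR j≡ _ = ⊥-elim (j≢ (sym j≡))
  ...     | inQ i≡ k≡ = inj₂ (same-line-of-two-points L (along x) x∈L y∈L (on-along x)
                                (joined-in-Q {x} {y} x∈X y∈X i≡ k≡) x≢y)

  lines-at : ∀ x → X x → LinesAt X x 1
  lines-at x x∈X = lookup (fibre x ∷ along x ∷ []) , at-x , distinct , complete
    where
    at-x : ∀ n → LineIn X (lookup (fibre x ∷ along x ∷ []) n) × On x (lookup (fibre x ∷ along x ∷ []) n)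
    at-x f0 = fibre⊆X x∈X , on-fibre x
    at-x (fs f0) = along⊆X x∈X , on-along x
    distinct : ∀ n m → SameLine (lookup (fibre x ∷ along x ∷ []) n) (lookup (fibre x ∷ along x ∷ []) m) → n ≡ m
    distinct f0 f0 _ = refl
    distinct f0 (fs f0) fibre~along = ⊥-elim (fibre≁along x fibre~along)
    distinct (fs f0) f0 along~fibre = ⊥-elim (fibre≁along x (≐-sym along~fibre))
    distinct (fs f0) (fs f0) _ = refl
    complete : ∀ L → LineIn X L → On x L → ∃ λ n → SameLine L (lookup (fibre x ∷ along x ∷ []) n)
    complete L L⊆X x∈L with classify x∈X L⊆X x∈L
    ... | inj₁ L~fibre = f0 , L~fibre
    ... | inj₂ L~along = fs f0 , L~along

  meets-fibre : ∀ {x w} → X x → X w → ¬ On x (fibre w) → GQAxiomAt X x (fibre w)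
  meets-fibre {x} {w} x∈X w∈X x∉fw with along-reaches x∈X w∈X
  ... | a , j≡ = y , y∈fw , x~y , unique
    where
    y = point (along x) a
    y∈fw : On y (fibre w)
    y∈fw = trans (over-i x∈X) (sym (over-i w∈X)) , j≡
    x~y : CollIn X x y
    x~y = (λ x≡y → x∉fw (subst (λ z → On z (fibre w)) (sym x≡y) y∈fw)) ,
          along x , along⊆X x∈X , on-along x , point-on (along x) a
    unique : ∀ z → On z (fibre w) → CollIn X x z → z ≡ y
    unique z z∈fw (_ , M , M⊆X , x∈M , z∈M) with classify x∈X M⊆X x∈M
    ... | inj₁ M~fx = ⊥-elim (x∉fw (trans (over-i x∈X) (sym (over-i w∈X)) ,
            trans (sym (proj₂ (proj₁ (M~fx z) z∈M))) (proj₂ z∈fw)))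
    ... | inj₂ M~ax with point-surjective (along x) (proj₁ (M~ax z) z∈M)
    ...   | b , refl = cong (point (along x)) (along-injective x b a (trans (proj₂ z∈fw) (sym j≡)))

  meets-along : ∀ {x w} → X x → X w → ¬ On x (along w) → GQAxiomAt X x (along w)
  meets-along {x} {w} x∈X w∈X x∉aw with along-reaches w∈X x∈X
  ... | a , j≡ = y , point-on (along w) a , x~y , unique
    where
    y = point (along w) a
    x~y : CollIn X x y
    x~y = (λ x≡y → x∉aw (subst (λ z → On z (along w)) (sym x≡y) (point-on (along w) a))) ,
          fibre x , fibre⊆X x∈X , on-fibre x , (trans (over-i w∈X) (sym (over-i x∈X)) , j≡)
    unique : ∀ z → On z (along w) → CollIn X x z → z ≡ y
    unique z z∈aw (_ , M , M⊆X , x∈M , z∈M) with classify x∈X M⊆X x∈M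
    ... | inj₁ M~fx with point-surjective (along w) z∈aw
    ...   | b , refl = cong (point (along w)) (along-injective w b a (trans (proj₂ (proj₁ (M~fx _) z∈M)) (sym j≡)))
    unique z z∈aw (_ , M , M⊆X , x∈M , z∈M) | inj₂ M~ax =
      ⊥-elim (x∉aw (proj₂ (same-along {w} {z} z∈aw x) (proj₁ (same-along {x} {z} (proj₁ (M~ax z) z∈M) x) (on-along x))))

  GQAxiomAt-cong : ∀ {x L M} → SameLine L M → GQAxiomAt X x M → GQAxiomAt X x L
  GQAxiomAt-cong L~M (y , y∈M , x~y , unique) =
    y , proj₂ (L~M y) y∈M , x~y , λ z z∈L → unique z (proj₁ (L~M z) z∈L)

  gq-axiom : ∀ x L → X x → LineIn X L → ¬ On x L → GQAxiomAt X x L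
  gq-axiom x L x∈X L⊆X x∉L = by-class (classify w∈X L⊆X (point-on L 0₃))
    where
    w∈X : X (point L 0₃)
    w∈X = L⊆X _ (point-on L 0₃)
    by-class : SameLine L (fibre (point L 0₃)) ⊎ SameLine L (along (point L 0₃)) → GQAxiomAt X x L
    by-class (inj₁ L~fw) = GQAxiomAt-cong {M = fibre (point L 0₃)} L~fw (meets-fibre {x} x∈X w∈X (x∉L ∘ proj₂ (L~fw x)))
    by-class (inj₂ L~aw) = GQAxiomAt-cong {M = along (point L 0₃)} L~aw (meets-along {x} x∈X w∈X (x∉L ∘ proj₂ (L~aw x)))

  grid : IsGrid (Qc i) X
  grid = record
    { sub = λ _ → over-i
    ; nonempty = (i , u , 0₃) , member refl (0₃ , translate-by-zero u d)
    ; linesAt = lines-at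
    ; gqAxiom = gq-axiom }

common-direction : V → V → V → Dir
common-direction a b c with b ≟ᵥ a | c ≟ᵥ a
... | no _ | _ = direction (b -ᵥ a)
... | yes _ | no _ = direction (c -ᵥ a)
... | yes _ | yes _ = d01

abstract
  area≡0⇒on-common-line : ∀ a b c → area a b c ≡ 0₃ →
    (∃ λ s → b ≡ a +ᵥ (s ·ᵥ dirV (common-direction a b c))) × (∃ λ s → c ≡ a +ᵥ (s ·ᵥ dirV (common-direction a b c)))
  area≡0⇒on-common-line = from-yes (allV? λ a → allV? λ b → allV? λ c → (area a b c ≟ 0₃) →-dec
    (any? (λ s → b ≟ᵥ a +ᵥ (s ·ᵥ dirV (common-direction a b c))) ×-dec
     any? (λ s → c ≟ᵥ a +ᵥ (s ·ᵥ dirV (common-direction a b c)))))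

module _ (iQ iQ̄ jL* : V) where
  open Setting true iQ iQ̄ jL*

  area≡0⇒InGrid : ∀ j₁ j₂ j₃ → area j₁ j₂ j₃ ≡ 0₃ → InGrid j₁ j₂ j₃
  area≡0⇒InGrid j₁ j₂ j₃ area≡0 =
    X , grid , S-line⊆X (0₃ , translate-by-zero j₁ (common-direction j₁ j₂ j₃)) ,
    S-line⊆X (proj₁ (area≡0⇒on-common-line j₁ j₂ j₃ area≡0)) ,
    S-line⊆X (proj₂ (area≡0⇒on-common-line j₁ j₂ j₃ area≡0))
    where
    open AffineGrid iQ j₁ (common-direction j₁ j₂ j₃) using (X; grid; OnAffineLine; member)
    S-line⊆X : ∀ {j} → OnAffineLine j → S-line j ⊆ X
    S-line⊆X on-line _ (refl , refl) = member refl on-line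

abstract
  loopShift-self : ∀ s j → loopShift s j j ≡ 0₃
  loopShift-self = from-yes (allV? λ s → allV? λ j → loopShift s j j ≟ 0₃)

  loopShift-antisym : ∀ s a b → loopShift s b a ≡ -₃ loopShift s a b
  loopShift-antisym = from-yes (allV? λ s → allV? λ a → allV? λ b → loopShift s b a ≟ -₃ loopShift s a b)

  loopShift-cocycle : ∀ s a b c → loopShift s a b +₃ loopShift s b c ≡ loopShift s a c +₃ area a b c
  loopShift-cocycle = from-yes (allV? λ s → allV? λ a → allV? λ b → allV? λ c →
    loopShift s a b +₃ loopShift s b c ≟ loopShift s a c +₃ area a b c)

  -₃-*₃ : ∀ a t → (-₃ a) *₃ t ≡ -₃ (a *₃ t)
  -₃-*₃ = from-yes (all? λ a → all? λ t → (-₃ a) *₃ t ≟ -₃ (a *₃ t))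

  *₃-distribʳ-+₃ : ∀ t a b → (a +₃ b) *₃ t ≡ a *₃ t +₃ b *₃ t
  *₃-distribʳ-+₃ = from-yes (all? λ t → all? λ a → all? λ b → (a +₃ b) *₃ t ≟ a *₃ t +₃ b *₃ t)

  +₃-*₃-cancel : ∀ c D t → D ≢ 0₃ → t ≢ 0₃ → (c +₃ D) *₃ t ≢ c *₃ t
  +₃-*₃-cancel = from-yes (all? λ c → all? λ D → all? λ t →
    ¬? (D ≟ 0₃) →-dec (¬? (t ≟ 0₃) →-dec ¬? ((c +₃ D) *₃ t ≟ c *₃ t)))

module _ (b : Bool) (iQ iQ̄ jL* : V) where
  open Setting b iQ iQ̄ jL*

  ThetaLaws : (V → V → Z3) → Set₁
  ThetaLaws θ =
    (∀ j → θ j j ≡ 0₃) ×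
    (∀ j₁ j₂ → θ j₂ j₁ ≡ -₃ θ j₁ j₂) ×
    (∀ j₁ j₂ j₃ → InGrid j₁ j₂ j₃ → θ j₁ j₂ +₃ θ j₂ j₃ ≡ θ j₁ j₃) ×
    (∀ j₁ j₂ j₃ → ¬ InGrid j₁ j₂ j₃ → θ j₁ j₂ +₃ θ j₂ j₃ ≢ θ j₁ j₃)

  ThetaLaws-cong : ∀ {θ θ′} → (∀ j₁ j₂ → θ j₁ j₂ ≡ θ′ j₁ j₂) → ThetaLaws θ′ → ThetaLaws θ
  ThetaLaws-cong {θ} {θ′} θ≡θ′ (diagonal , antisymmetric , grid , non-grid) =
    (λ j → trans (θ≡θ′ j j) (diagonal j)) ,
    (λ j₁ j₂ → trans (θ≡θ′ j₂ j₁) (trans (antisymmetric j₁ j₂) (cong -₃_ (sym (θ≡θ′ j₁ j₂))))) ,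
    (λ j₁ j₂ j₃ g → trans sum≡ (trans (grid j₁ j₂ j₃ g) (sym (θ≡θ′ j₁ j₃)))) ,
    (λ j₁ j₂ j₃ ¬g e → non-grid j₁ j₂ j₃ ¬g (trans (sym sum≡) (trans e (θ≡θ′ j₁ j₃))))
    where
    sum≡ : ∀ {j₁ j₂ j₃} → θ j₁ j₂ +₃ θ j₂ j₃ ≡ θ′ j₁ j₂ +₃ θ′ j₂ j₃
    sum≡ {j₁} {j₂} {j₃} = cong₂ _+₃_ (θ≡θ′ j₁ j₂) (θ≡θ′ j₂ j₃)

  Theorem : (Z3 → PSet) → Set₁
  Theorem W = IsIndexing W →
    (Σ (V → V → Z3) λ θ → ∀ j₁ j₂ → IsTheta W j₁ j₂ (θ j₁ j₂)) ×
    ((θ : V → V → Z3) → (∀ j₁ j₂ → IsTheta W j₁ j₂ (θ j₁ j₂)) → ThetaLaws θ)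

module _ (iQ iQ̄ jL* : V) (iQ≢iQ̄ : iQ ≢ iQ̄) (W : Z3 → PSet) (idx : Setting.IsIndexing true iQ iQ̄ jL* W) where
  open TrueCase iQ iQ̄ jL*
  open Indexed W idx

  θ₀-composition : ∀ j₁ j₂ j₃ → θ₀ j₁ j₂ +₃ θ₀ j₂ j₃ ≡ θ₀ j₁ j₃ +₃ area j₁ j₂ j₃ *₃ step
  θ₀-composition j₁ j₂ j₃ = begin
    θ₀ j₁ j₂ +₃ θ₀ j₂ j₃
      ≡⟨ sym (*₃-distribʳ-+₃ step (loopShift jL* j₁ j₂) (loopShift jL* j₂ j₃)) ⟩
    (loopShift jL* j₁ j₂ +₃ loopShift jL* j₂ j₃) *₃ step
      ≡⟨ cong (_*₃ step) (loopShift-cocycle jL* j₁ j₂ j₃) ⟩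
    (loopShift jL* j₁ j₃ +₃ area j₁ j₂ j₃) *₃ step
      ≡⟨ *₃-distribʳ-+₃ step (loopShift jL* j₁ j₃) (area j₁ j₂ j₃) ⟩
    θ₀ j₁ j₃ +₃ area j₁ j₂ j₃ *₃ step
      ∎
    where open ≡-Reasoning

  θ₀-laws : ThetaLaws true iQ iQ̄ jL* θ₀
  θ₀-laws =
    (λ j → cong (_*₃ step) (loopShift-self jL* j)) ,
    (λ j₁ j₂ → trans (cong (_*₃ step) (loopShift-antisym jL* j₁ j₂)) (-₃-*₃ (loopShift jL* j₁ j₂) step)) ,
    (λ j₁ j₂ j₃ g → trans (θ₀-composition j₁ j₂ j₃)
      (trans (cong (λ D → θ₀ j₁ j₃ +₃ D *₃ step) (InGrid⇒area≡0 iQ iQ̄ jL* j₁ j₂ j₃ g)) (+₃-identityʳ (θ₀ j₁ j₃)))) ,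
    (λ j₁ j₂ j₃ ¬g e → +₃-*₃-cancel (loopShift jL* j₁ j₃) (area j₁ j₂ j₃) step
      (¬g ∘ area≡0⇒InGrid iQ iQ̄ jL* j₁ j₂ j₃) (step≢0 iQ≢iQ̄)
      (trans (*₃-distribʳ-+₃ step (loopShift jL* j₁ j₃) (area j₁ j₂ j₃)) (trans (sym (θ₀-composition j₁ j₂ j₃)) e)))

theorem-true : ∀ iQ iQ̄ → iQ ≢ iQ̄ → ∀ jL* W → Theorem true iQ iQ̄ jL* W
theorem-true iQ iQ̄ iQ≢iQ̄ jL* W idx =
  (θ₀ , θ₀-IsTheta) ,
  λ θ isθ → ThetaLaws-cong true iQ iQ̄ jL* (λ j₁ j₂ → IsTheta-unique (isθ j₁ j₂)) (θ₀-laws iQ iQ̄ jL* iQ≢iQ̄ W idx)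
  where
  open TrueCase iQ iQ̄ jL*
  open Indexed W idx

module Swapped (iQ iQ̄ jL* : V) where
  module T = Setting true iQ iQ̄ jL*
  module F = Setting false iQ iQ̄ jL*

  swapped : PSet → PSet
  swapped = image swapAut

  G*-swap : ∀ {z} → T.G* z → F.G* (swap z)
  G*-swap (z∈R* , inj₁ z∈Q) = z∈R* , inj₁ z∈Q
  G*-swap (z∈R* , inj₂ (inj₁ z∈Q̄)) = z∈R* , inj₂ (inj₁ z∈Q̄)
  G*-swap (z∈R* , inj₂ (inj₂ (x , x∈Q̄ , x↦z))) = z∈R* , inj₂ (inj₂ (swap x , x∈Q̄ , Refl-image swapAut (Qc iQ) x↦z))

  G*-swap⁻ : ∀ {z} → F.G* z → T.G* (swap z)
  G*-swap⁻ (z∈R* , inj₁ z∈Q) = z∈R* , inj₁ z∈Q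
  G*-swap⁻ (z∈R* , inj₂ (inj₁ z∈Q̄)) = z∈R* , inj₂ (inj₁ z∈Q̄)
  G*-swap⁻ (z∈R* , inj₂ (inj₂ (x , x∈Q̄ , x↦z))) = z∈R* , inj₂ (inj₂ (swap x , x∈Q̄ , Refl-image swapAut (Rc iQ) x↦z))

  Φ-swap : ∀ j₁ j₂ {x z} → F.Φ j₁ j₂ x z → T.Φ j₁ j₂ (swap x) (swap z)
  Φ-swap j₁ j₂ (y₁ , y₂ , x↦y₁ , y₁↦y₂ , y₂↦z) =
    swap y₁ , swap y₂ , Proj-image swapAut (Qc j₁) x↦y₁ , Proj-image swapAut (Qc j₂) y₁↦y₂ ,
    Proj-image swapAut (Qc jL*) y₂↦z

  Φ-swap⁻ : ∀ j₁ j₂ {x z} → T.Φ j₁ j₂ x z → F.Φ j₁ j₂ (swap x) (swap z)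
  Φ-swap⁻ j₁ j₂ (y₁ , y₂ , x↦y₁ , y₁↦y₂ , y₂↦z) =
    swap y₁ , swap y₂ , Proj-image swapAut (Rc j₁) x↦y₁ , Proj-image swapAut (Rc j₂) y₁↦y₂ ,
    Proj-image swapAut (Rc jL*) y₂↦z

  IsIndexing-swap : ∀ W → F.IsIndexing W → T.IsIndexing (swapped ∘ W)
  IsIndexing-swap W (W-W2 , W-injective , W-complete) =
    (λ n → SubGQ-image swapAut (W n) (proj₁ (W-W2 n)) , λ z z∈G* → proj₂ (W-W2 n) (swap z) (G*-swap z∈G*)) ,
    (λ n m e → W-injective n m (e ∘ swap)) ,
    λ X X-W2 G*⊆X → let (n , e) = W-complete (swapped X) (SubGQ-image swapAut X X-W2) (λ z z∈G* → G*⊆X (swap z) (G*-swap⁻ z∈G*))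
                    in n , e ∘ swap

  IsTheta-swap⁻ : ∀ W j₁ j₂ t → T.IsTheta (swapped ∘ W) j₁ j₂ t → F.IsTheta W j₁ j₂ t
  IsTheta-swap⁻ W j₁ j₂ t isθ n z =
    (λ (x , x∈W , x↦z) → proj₁ (isθ n (swap z)) (swap x , x∈W , Φ-swap j₁ j₂ x↦z)) ,
    λ z∈W → let (x , x∈W , x↦z) = proj₂ (isθ n (swap z)) z∈W in swap x , x∈W , Φ-swap⁻ j₁ j₂ x↦z

  IsTheta-swap : ∀ W j₁ j₂ t → F.IsTheta W j₁ j₂ t → T.IsTheta (swapped ∘ W) j₁ j₂ t
  IsTheta-swap W j₁ j₂ t isθ n z =
    (λ (x , x∈W , x↦z) → proj₁ (isθ n (swap z)) (swap x , x∈W , Φ-swap⁻ j₁ j₂ x↦z)) ,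
    λ z∈W → let (x , x∈W , x↦z) = proj₂ (isθ n (swap z)) z∈W in swap x , x∈W , Φ-swap j₁ j₂ x↦z

  InGrid-swap : ∀ j₁ j₂ j₃ → F.InGrid j₁ j₂ j₃ → T.InGrid j₁ j₂ j₃
  InGrid-swap j₁ j₂ j₃ (X , X-grid , ℓ₁⊆X , ℓ₂⊆X , ℓ₃⊆X) =
    swapped X , SubGQ-image swapAut X X-grid , ℓ₁⊆X ∘ swap , ℓ₂⊆X ∘ swap , ℓ₃⊆X ∘ swap

  InGrid-swap⁻ : ∀ j₁ j₂ j₃ → T.InGrid j₁ j₂ j₃ → F.InGrid j₁ j₂ j₃
  InGrid-swap⁻ j₁ j₂ j₃ (X , X-grid , ℓ₁⊆X , ℓ₂⊆X , ℓ₃⊆X) =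
    swapped X , SubGQ-image swapAut X X-grid , ℓ₁⊆X ∘ swap , ℓ₂⊆X ∘ swap , ℓ₃⊆X ∘ swap

  ThetaLaws-swap⁻ : ∀ {θ} → ThetaLaws true iQ iQ̄ jL* θ → ThetaLaws false iQ iQ̄ jL* θ
  ThetaLaws-swap⁻ (diagonal , antisymmetric , grid , non-grid) =
    diagonal , antisymmetric ,
    (λ j₁ j₂ j₃ g → grid j₁ j₂ j₃ (InGrid-swap j₁ j₂ j₃ g)) ,
    (λ j₁ j₂ j₃ ¬g → non-grid j₁ j₂ j₃ (¬g ∘ InGrid-swap⁻ j₁ j₂ j₃))

  theorem-false : iQ ≢ iQ̄ → ∀ W → Theorem false iQ iQ̄ jL* W
  theorem-false iQ≢iQ̄ W idx =
    (θ₀ , λ j₁ j₂ → IsTheta-swap⁻ W j₁ j₂ (θ₀ j₁ j₂) (θ₀-IsTheta j₁ j₂)) ,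
    λ θ isθ → ThetaLaws-swap⁻ (proj₂ (theorem-true iQ iQ̄ iQ≢iQ̄ jL* (swapped ∘ W) swapped-idx) θ
      λ j₁ j₂ → IsTheta-swap W j₁ j₂ (θ j₁ j₂) (isθ j₁ j₂))
    where
    swapped-idx : T.IsIndexing (swapped ∘ W)
    swapped-idx = IsIndexing-swap W idx
    open TrueCase.Indexed iQ iQ̄ jL* (swapped ∘ W) swapped-idx using (θ₀; θ₀-IsTheta)

lemma3p2 : (b : Bool) (iQ iQ̄ : V) → iQ ≢ iQ̄ → (jL* : V) → (W : Z3 → PSet) →
    let open Setting b iQ iQ̄ jL* in
    IsIndexing W →
    (Σ (V → V → Z3) λ θ → ∀ j₁ j₂ → IsTheta W j₁ j₂ (θ j₁ j₂)) ×
    ((θ : V → V → Z3) → (∀ j₁ j₂ → IsTheta W j₁ j₂ (θ j₁ j₂)) →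
      (∀ j → θ j j ≡ 0₃) ×
      (∀ j₁ j₂ → θ j₂ j₁ ≡ -₃ θ j₁ j₂) ×
      (∀ j₁ j₂ j₃ → InGrid j₁ j₂ j₃ → θ j₁ j₂ +₃ θ j₂ j₃ ≡ θ j₁ j₃) ×
      (∀ j₁ j₂ j₃ → ¬ InGrid j₁ j₂ j₃ → θ j₁ j₂ +₃ θ j₂ j₃ ≢ θ j₁ j₃))
lemma3p2 true iQ iQ̄ iQ≢iQ̄ jL* = theorem-true iQ iQ̄ iQ≢iQ̄ jL*
lemma3p2 false iQ iQ̄ iQ≢iQ̄ jL* = Swapped.theorem-false iQ iQ̄ jL* iQ≢iQ̄
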